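{- Let $p>3$ be a prime and $\kappa\in\mathbb{Z}$ with $\kappa\not\equiv4\pmod p$. Put $\eta=16\kappa^2-68\kappa+41$ and assume $(\kappa^2-13\kappa+11)\cdot\eta\not\equiv0$ and $5(\kappa^2-73\kappa+61)\not\equiv0\pmod p$. Let $B_{2,\kappa}(y)=y^4-3y^3-(2\kappa-7)y^2+(3\kappa-4)y+\kappa^2-6\kappa+4\in\mathbb{F}_p[y]$ and let $N_p$ be the number of solutions of $B_{2,\kappa}(y)=0$ in $\mathbb{F}_p$ counted with multiplicity. Then $N_p=4$ if $\left(\frac{\eta}{p}\right)=1$ and $\left(\frac{5}{p}\right)=\left(\frac{8\kappa-17+2s}{p}\right)=\left(\frac{8\kappa-17-2s}{p}\right)=1$, where $s\in\mathbb{F}_p$ is any element with $s^2=\eta$; $N_p=2$ if $\left(\frac{\eta}{p}\right)=-1$ and $\left(\frac{5}{p}\right)=1$; $N_p=0$ otherwise.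
   Context: $\kappa$ and all coefficients are regarded in $\mathbb{F}_p$; $\left(\frac{\cdot}{p}\right)$ denotes the Legendre symbol. -}

module Defs where

open import Data.Nat as ℕ using (ℕ; zero; suc)
open import Data.Nat.Divisibility using (_∣_)
open import Data.Integer as ℤ using (ℤ; +_; _-_; _*_; ∣_∣; -_)
open import Data.List using (List; []; _∷_; map; upTo)
open import Data.Nat.ListAction using (sum)
open import Data.Product using (Σ; ∃; _×_)
open import Relation.Nullary using (¬_)

infix 4 _≡_[mod_] _≡P_[mod_]

_≡_[mod_] : ℤ → ℤ → ℕ → Set
a ≡ b [mod p ] = p ∣ ∣ a - b ∣

IsSquareMod : ℕ → ℤ → Set
IsSquareMod p a = ∃ λ (x : ℤ) → (x * x) ≡ a [mod p ]

LegendreIs1 : ℕ → ℤ → Set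
LegendreIs1 p a = ¬ (a ≡ + 0 [mod p ]) × IsSquareMod p a

LegendreIsMinus1 : ℕ → ℤ → Set
LegendreIsMinus1 p a = ¬ (a ≡ + 0 [mod p ]) × ¬ IsSquareMod p a

-- Polynomials over ℤ (read in F_p[y]) as coefficient lists,
-- lowest degree first.

Poly : Set
Poly = List ℤ

infixl 6 _+P_
infixl 7 _*P_
infixr 8 _^P_

_+P_ : Poly → Poly → Poly
[] +P g = g
f +P [] = f
(a ∷ f) +P (b ∷ g) = (a ℤ.+ b) ∷ (f +P g)

scale : ℤ → Poly → Poly
scale c = map (c *_)

_*P_ : Poly → Poly → Poly
[] *P g = []
(a ∷ f) *P g = scale a g +P (+ 0 ∷ (f *P g))

_^P_ : Poly → ℕ → Poly
f ^P zero = + 1 ∷ []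
f ^P suc m = f *P (f ^P m)

coeff : Poly → ℕ → ℤ
coeff [] i = + 0
coeff (a ∷ f) zero = a
coeff (a ∷ f) (suc i) = coeff f i

_≡P_[mod_] : Poly → Poly → ℕ → Set
f ≡P g [mod p ] = ∀ i → coeff f i ≡ coeff g i [mod p ]

DividesP : ℕ → Poly → Poly → Set
DividesP p g f = ∃ λ (q : Poly) → f ≡P (g *P q) [mod p ]

linP : ℤ → Poly
linP a = (- a) ∷ + 1 ∷ []

IsMultiplicity : ℕ → Poly → ℤ → ℕ → Set
IsMultiplicity p f a m =
  DividesP p (linP a ^P m) f × ¬ DividesP p (linP a ^P suc m) f

-- Number of roots in F_p = {0,…,p-1} counted with multiplicity is n:
-- for (any, equivalently the unique) multiplicity function,
-- the sum of multiplicities over all residues equals n.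
RootCountIs : ℕ → Poly → ℕ → Set
RootCountIs p f n =
  (mult : ℕ → ℕ) → (∀ i → i ℕ.< p → IsMultiplicity p f (+ i) (mult i)) →
  sum (map mult (upTo p)) ≡ n
  where open import Relation.Binary.PropositionalEquality using (_≡_)

η : ℤ → ℤ
η κ = + 16 * κ * κ - + 68 * κ ℤ.+ + 41

B₂ : ℤ → Poly
B₂ κ = (κ * κ - + 6 * κ ℤ.+ + 4) ∷ (+ 3 * κ - + 4) ∷ (- (+ 2 * κ - + 7))
       ∷ (- (+ 3)) ∷ + 1 ∷ []

Case4 : ℕ → ℤ → Set
Case4 p κ = LegendreIs1 p (η κ) × LegendreIs1 p (+ 5) ×
  ∃ λ (s : ℤ) → (s * s) ≡ η κ [mod p ] ×
    LegendreIs1 p (+ 8 * κ - + 17 ℤ.+ + 2 * s) ×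
    LegendreIs1 p (+ 8 * κ - + 17 - + 2 * s)

Case2 : ℕ → ℤ → Set
Case2 p κ = LegendreIsMinus1 p (η κ) × LegendreIs1 p (+ 5)

-- For r with r² = 5 we have 4·B₂(y) = P_r(y)·P_{-r}(y), where P_r(y) = 2y² - (3 - r)y - 2κ + 6 - 2r,
-- and a root forces 5 to be a square because 4·B₂(y) = W(y)² - 5(y - 2)² with W(2) = 2(κ - 4) ≢ 0.
-- The quadratics P_r and P_{-r} have no common root, and 8·P_r(y) = (4y - 3 + r)² - E_r with
-- E_r = 16κ - 34 + 10r, so P_r has two simple roots or none according as E_r is a square or not.
-- Since E_r·E_{-r} = 16η and E_r + E_{-r} = 4(8κ - 17), both E_{±r} are squares exactly when η and
-- 8κ - 17 ± 2s are (then 4s = √E_r·√E_{-r} and 8κ - 17 ± 2s = ((√E_r ± √E_{-r})/2)²), and exactly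
-- one of them is a square when η is not, since a product of two non-squares mod p is a square.

module Submission where

open import Defs
open import Data.Nat as ℕ using (ℕ; zero; suc; _<_; _≤_; z≤n; s≤s; z<s; s<s)
import Data.Nat.Properties as ℕₚ
import Data.Nat.Divisibility as ℕ∣
open import Data.Nat.Primality using (Prime; euclidsLemma; prime⇒nonZero; prime⇒irreducible)
open import Data.Nat.Coprimality using (coprime-Bézout; prime⇒coprime)
open import Data.Nat.GCD using (module Bézout)
open import Data.Nat.ListAction using (sum)
import Algebra.Properties.CommutativeSemigroup ℕₚ.+-commutativeSemigroup as ℕ-+
open import Data.Integer as ℤ using (ℤ; +_; _+_; _-_; _*_; -_; ∣_∣)
import Data.Integer.Properties as ℤₚ
import Data.Integer.Divisibility.Signed as ℤ∣
import Data.Integer.DivMod as ℤ/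
open import Data.Integer.Tactic.RingSolver using (solve-∀)
open import Data.Fin as Fin using (Fin; toℕ; fromℕ<; splitAt; join)
import Data.Fin.Properties as Finₚ
open import Data.List using (List; []; _∷_; map; length; upTo; applyUpTo)
open import Data.List.Properties using (map-upTo; length-map)
open import Data.List.Relation.Unary.All as All using (All; []; _∷_)
open import Data.List.Relation.Unary.All.Properties using (map⁺)
open import Data.List.Relation.Unary.Any using (Any; here; there)
open import Data.List.Relation.Unary.AllPairs using (AllPairs; []; _∷_)
open import Data.Bool using (if_then_else_)
open import Data.Product using (∃; _×_; _,_; proj₁; proj₂; map₂)
open import Data.Sum as Sum using (_⊎_; inj₁; inj₂; [_,_]′)
open import Data.Empty using (⊥; ⊥-elim)
open import Function using (_∘_)
open import Relation.Nullary using (¬_; Dec; yes; no)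
open import Relation.Nullary.Decidable using (decidable-stable; map′)
open import Relation.Binary.PropositionalEquality
open import Relation.Binary.Bundles using (Setoid)
import Relation.Binary.Reasoning.Setoid as SetoidReasoning

module Congruence (p : ℕ) where

  infix 4 _≈_

  -- A record rather than a synonym of _≡_[mod_], so that both sides can be inferred.
  record _≈_ (a b : ℤ) : Set where
    constructor ≈-intro
    field divides : + p ℤ∣.∣ a - b

  open _≈_ public

  ≈⇒≡[mod] : ∀ {a b} → a ≈ b → a ≡ b [mod p ]
  ≈⇒≡[mod] e = ℤ∣.∣⇒∣ᵤ (divides e)

  ≡[mod]⇒≈ : ∀ {a b} → a ≡ b [mod p ] → a ≈ b
  ≡[mod]⇒≈ e = ≈-intro (ℤ∣.∣ᵤ⇒∣ e)

  private
    ∣⇒≈ : ∀ {a b c} → c ≡ a - b → + p ℤ∣.∣ c → a ≈ b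
    ∣⇒≈ refl d = ≈-intro d

  ≈-reflexive : ∀ {a b} → a ≡ b → a ≈ b
  ≈-reflexive {a} refl = ≈-intro (ℤ∣.divides (+ 0) (ℤₚ.+-inverseʳ a))

  ≈-refl : ∀ {a} → a ≈ a
  ≈-refl = ≈-reflexive refl

  ≈-sym : ∀ {a b} → a ≈ b → b ≈ a
  ≈-sym {a} {b} e = ∣⇒≈ (swap a b) (ℤ∣.∣m⇒∣-m (divides e))
    where
    swap : ∀ a b → - (a - b) ≡ b - a
    swap = solve-∀

  ≈-trans : ∀ {a b c} → a ≈ b → b ≈ c → a ≈ c
  ≈-trans {a} {b} {c} e f = ∣⇒≈ (telescope a b c) (ℤ∣.∣m∣n⇒∣m+n (divides e) (divides f))
    where
    telescope : ∀ a b c → (a - b) + (b - c) ≡ a - c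
    telescope = solve-∀

  ≈-setoid : Setoid _ _
  ≈-setoid = record { _≈_ = _≈_ ; isEquivalence = record { refl = ≈-refl ; sym = ≈-sym ; trans = ≈-trans } }

  module ≈-Reasoning = SetoidReasoning ≈-setoid

  +-cong : ∀ {a b c d} → a ≈ b → c ≈ d → a + c ≈ b + d
  +-cong {a} {b} {c} {d} e f = ∣⇒≈ (regroup a b c d) (ℤ∣.∣m∣n⇒∣m+n (divides e) (divides f))
    where
    regroup : ∀ a b c d → (a - b) + (c - d) ≡ (a + c) - (b + d)
    regroup = solve-∀

  -‿cong : ∀ {a b} → a ≈ b → - a ≈ - b
  -‿cong {a} {b} e = ∣⇒≈ (regroup a b) (ℤ∣.∣m⇒∣-m (divides e))
    where
    regroup : ∀ a b → - (a - b) ≡ - a - - b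
    regroup = solve-∀

  *-cong : ∀ {a b c d} → a ≈ b → c ≈ d → a * c ≈ b * d
  *-cong {a} {b} {c} {d} e f =
    ∣⇒≈ (regroup a b c d) (ℤ∣.∣m∣n⇒∣m+n (ℤ∣.∣m⇒∣m*n c (divides e)) (ℤ∣.∣n⇒∣m*n b (divides f)))
    where
    regroup : ∀ a b c d → (a - b) * c + b * (c - d) ≡ a * c - b * d
    regroup = solve-∀

  sub-cong : ∀ {a b c d} → a ≈ b → c ≈ d → a - c ≈ b - d
  sub-cong e f = +-cong e (-‿cong f)

  +-congˡ : ∀ c {a b} → a ≈ b → c + a ≈ c + b
  +-congˡ c = +-cong (≈-refl {c})

  +-congʳ : ∀ c {a b} → a ≈ b → a + c ≈ b + c
  +-congʳ c e = +-cong e (≈-refl {c})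

  *-congˡ : ∀ c {a b} → a ≈ b → c * a ≈ c * b
  *-congˡ c = *-cong (≈-refl {c})

  *-congʳ : ∀ c {a b} → a ≈ b → a * c ≈ b * c
  *-congʳ c e = *-cong e (≈-refl {c})

  a-b≈0⇒a≈b : ∀ {a b} → a - b ≈ + 0 → a ≈ b
  a-b≈0⇒a≈b {a} {b} e = ∣⇒≈ (ℤₚ.+-identityʳ (a - b)) (divides e)

  a≈b⇒a-b≈0 : ∀ {a b} → a ≈ b → a - b ≈ + 0
  a≈b⇒a-b≈0 {a} {b} e = ∣⇒≈ (sym (ℤₚ.+-identityʳ (a - b))) (divides e)

  p≈0 : + p ≈ + 0
  p≈0 = ≈-intro (ℤ∣.divides (+ 1) (trans (ℤₚ.+-identityʳ (+ p)) (sym (ℤₚ.*-identityˡ (+ p)))))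

  *-≈0ˡ : ∀ {a} b → a ≈ + 0 → a * b ≈ + 0
  *-≈0ˡ b e = *-congʳ b e

  *-≈0ʳ : ∀ a {b} → b ≈ + 0 → a * b ≈ + 0
  *-≈0ʳ a e = ≈-trans (*-congˡ a e) (≈-reflexive (ℤₚ.*-zeroʳ a))

  x+z≈x : ∀ x {z} → z ≈ + 0 → x + z ≈ x
  x+z≈x x e = ≈-trans (+-congˡ x e) (≈-reflexive (ℤₚ.+-identityʳ x))

  x-z≈x : ∀ x {z} → z ≈ + 0 → x - z ≈ x
  x-z≈x x e = x+z≈x x (-‿cong e)

  ≈0⇒∣∣ : ∀ {a} → a ≈ + 0 → p ℕ∣.∣ ∣ a ∣
  ≈0⇒∣∣ {a} e = subst (λ x → p ℕ∣.∣ ∣ x ∣) (ℤₚ.+-identityʳ a) (ℤ∣.∣⇒∣ᵤ (divides e))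

  ∣∣⇒≈0 : ∀ {a} → p ℕ∣.∣ ∣ a ∣ → a ≈ + 0
  ∣∣⇒≈0 {a} d = ≈-intro (ℤ∣.∣ᵤ⇒∣ (subst (λ x → p ℕ∣.∣ ∣ x ∣) (sym (ℤₚ.+-identityʳ a)) d))

  private
    divisible-below⇒0 : ∀ {n} → p ℕ∣.∣ n → n < p → n ≡ 0
    divisible-below⇒0 {zero}  _ _   = refl
    divisible-below⇒0 {suc n} d n<p = ⊥-elim (ℕ∣.>⇒∤ n<p d)

    ≤-≈⇒≡ : ∀ {x y} → x ≤ y → y < p → + x ≈ + y → x ≡ y
    ≤-≈⇒≡ {x} {y} x≤y y<p e = ℕₚ.≤-antisym x≤y (ℕₚ.m∸n≡0⇒m≤n y∸x≡0)
      where
      p∣y∸x : p ℕ∣.∣ y ℕ.∸ x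
      p∣y∸x = subst (p ℕ∣.∣_) (trans (cong ∣_∣ (ℤₚ.m-n≡m⊖n x y)) (ℤₚ.∣⊖∣-≤ x≤y)) (≈⇒≡[mod] e)
      y∸x≡0 : y ℕ.∸ x ≡ 0
      y∸x≡0 = divisible-below⇒0 p∣y∸x (ℕₚ.≤-<-trans (ℕₚ.m∸n≤m y x) y<p)

  +-injective-below : ∀ {x y} → x < p → y < p → + x ≈ + y → x ≡ y
  +-injective-below {x} {y} x<p y<p e with ℕₚ.≤-total x y
  ... | inj₁ x≤y = ≤-≈⇒≡ x≤y y<p e
  ... | inj₂ y≤x = sym (≤-≈⇒≡ y≤x x<p (≈-sym e))

  +n≉0 : ∀ {n} → 0 < n → n < p → ¬ (+ n ≈ + 0)
  +n≉0 {suc n} _ n<p e with +-injective-below n<p (ℕₚ.<-trans z<s n<p) e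
  ... | ()

  Square : ℤ → Set
  Square a = ∃ λ x → x * x ≈ a

  Square⇒IsSquareMod : ∀ {a} → Square a → IsSquareMod p a
  Square⇒IsSquareMod = map₂ ≈⇒≡[mod]

  IsSquareMod⇒Square : ∀ {a} → IsSquareMod p a → Square a
  IsSquareMod⇒Square = map₂ ≡[mod]⇒≈

  LegendreIs1-intro : ∀ {a} → ¬ (a ≈ + 0) → Square a → LegendreIs1 p a
  LegendreIs1-intro a≉0 □a = a≉0 ∘ ≡[mod]⇒≈ , Square⇒IsSquareMod □a

even⊎odd : ∀ n → (∃ λ m → n ≡ m ℕ.+ m) ⊎ (∃ λ m → n ≡ suc (m ℕ.+ m))
even⊎odd zero = inj₁ (0 , refl)
even⊎odd (suc n) with even⊎odd n
... | inj₁ (m , refl) = inj₂ (m , refl)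
... | inj₂ (m , refl) = inj₁ (suc m , cong suc (sym (ℕₚ.+-suc m m)))

2∣m+m : ∀ m → 2 ℕ∣.∣ m ℕ.+ m
2∣m+m m = ℕ∣.divides m (trans (cong (m ℕ.+_) (sym (ℕₚ.+-identityʳ m))) (ℕₚ.*-comm 2 m))

odd-prime : ∀ {p} → Prime p → 2 < p → ∃ λ m → p ≡ suc (m ℕ.+ m)
odd-prime {p} p-prime 2<p with even⊎odd p
... | inj₂ odd = odd
... | inj₁ (m , refl) with prime⇒irreducible p-prime (2∣m+m m)
...   | inj₁ ()
...   | inj₂ 2≡m+m = ⊥-elim (ℕₚ.<-irrefl 2≡m+m 2<p)

pos-+-* : ∀ k l m o q → k ℕ.+ l ℕ.* m ≡ o ℕ.* q → + k + + l * + m ≡ + o * + q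
pos-+-* k l m o q e = begin
  + k + + l * + m       ≡⟨ cong (λ z → + k + z) (ℤₚ.pos-* l m) ⟨
  + k + + (l ℕ.* m)     ≡⟨ ℤₚ.pos-+ k (l ℕ.* m) ⟨
  + (k ℕ.+ l ℕ.* m)     ≡⟨ cong +_ e ⟩
  + (o ℕ.* q)           ≡⟨ ℤₚ.pos-* o q ⟩
  + o * + q             ∎
  where open ≡-Reasoning

module PrimeField (p : ℕ) (p-prime : Prime p) where

  open Congruence p

  instance
    p≢0 : ℕ.NonZero p
    p≢0 = prime⇒nonZero p-prime

  x*y≈0⇒x≈0⊎y≈0 : ∀ {x y} → x * y ≈ + 0 → x ≈ + 0 ⊎ y ≈ + 0
  x*y≈0⇒x≈0⊎y≈0 {x} {y} e =
    Sum.map ∣∣⇒≈0 ∣∣⇒≈0 (euclidsLemma ∣ x ∣ ∣ y ∣ p-prime (subst (p ℕ∣.∣_) (ℤₚ.abs-* x y) (≈0⇒∣∣ e)))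

  x*y≈0⇒y≈0 : ∀ {x y} → ¬ (x ≈ + 0) → x * y ≈ + 0 → y ≈ + 0
  x*y≈0⇒y≈0 x≉0 e = [ (λ x≈0 → ⊥-elim (x≉0 x≈0)) , (λ y≈0 → y≈0) ]′ (x*y≈0⇒x≈0⊎y≈0 e)

  x*x≈0⇒x≈0 : ∀ {x} → x * x ≈ + 0 → x ≈ + 0
  x*x≈0⇒x≈0 e = [ (λ x≈0 → x≈0) , (λ x≈0 → x≈0) ]′ (x*y≈0⇒x≈0⊎y≈0 e)

  *-≉0 : ∀ {x y} → ¬ (x ≈ + 0) → ¬ (y ≈ + 0) → ¬ (x * y ≈ + 0)
  *-≉0 x≉0 y≉0 e = y≉0 (x*y≈0⇒y≈0 x≉0 e)

  residue : ℤ → ℕ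
  residue a = a ℤ/.%ℕ p

  residue<p : ∀ a → residue a < p
  residue<p a = ℤ/.n%ℕd<d a p

  residue≈ : ∀ a → + residue a ≈ a
  residue≈ a = ≈-sym (begin
    a                                    ≡⟨ ℤ/.a≡a%ℕn+[a/ℕn]*n a p ⟩
    + residue a + (a ℤ/./ℕ p) * + p      ≈⟨ +-congˡ (+ residue a) (*-≈0ʳ (a ℤ/./ℕ p) p≈0) ⟩
    + residue a + + 0                    ≡⟨ ℤₚ.+-identityʳ (+ residue a) ⟩
    + residue a                          ∎)
    where open ≈-Reasoning

  residue≡0⇒≈0 : ∀ a → residue a ≡ 0 → a ≈ + 0
  residue≡0⇒≈0 a r≡0 = ≈-trans (≈-sym (residue≈ a)) (≈-reflexive (cong +_ r≡0))

  ≈0⇒residue≡0 : ∀ {a} → a ≈ + 0 → residue a ≡ 0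
  ≈0⇒residue≡0 {a} e = +-injective-below (residue<p a) (ℕₚ.≤-<-trans z≤n (residue<p a)) (≈-trans (residue≈ a) e)

  ≈0? : ∀ a → Dec (a ≈ + 0)
  ≈0? a = map′ (residue≡0⇒≈0 a) ≈0⇒residue≡0 (residue a ℕ.≟ 0)

  inverse-below : ∀ n .{{_ : ℕ.NonZero n}} → n < p → ∃ λ b → + n * b ≈ + 1
  inverse-below n n<p with coprime-Bézout (prime⇒coprime p-prime n<p)
  ... | Bézout.+- x y eq = - + y , (begin
    + n * - + y               ≡⟨ regroup (+ n) (+ y) ⟩
    + 1 - (+ 1 + + y * + n)   ≡⟨ cong (λ z → + 1 - z) (pos-+-* 1 y n x p eq) ⟩
    + 1 - + x * + p           ≈⟨ sub-cong (≈-refl {+ 1}) (*-≈0ʳ (+ x) p≈0) ⟩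
    + 1                       ∎)
    where
    open ≈-Reasoning
    regroup : ∀ n y → n * - y ≡ + 1 - (+ 1 + y * n)
    regroup = solve-∀
  ... | Bézout.-+ x y eq = + y , (begin
    + n * + y                 ≡⟨ ℤₚ.*-comm (+ n) (+ y) ⟩
    + y * + n                 ≡⟨ pos-+-* 1 x p y n eq ⟨
    + 1 + + x * + p           ≈⟨ +-congˡ (+ 1) (*-≈0ʳ (+ x) p≈0) ⟩
    + 1                       ∎)
    where open ≈-Reasoning

  inverse : ∀ {a} → ¬ (a ≈ + 0) → ∃ λ b → a * b ≈ + 1
  inverse {a} a≉0 with residue a in eq
  ... | zero  = ⊥-elim (a≉0 (residue≡0⇒≈0 a eq))
  ... | suc n with inverse-below (suc n) (subst (_< p) eq (residue<p a))
  ...   | b , nb≈1 = b , ≈-trans (*-congʳ b (≈-trans (≈-sym (residue≈ a)) (≈-reflexive (cong +_ eq)))) nb≈1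

  card-nonzero-residues : ∀ {n} (f : Fin n → ℤ) → (∀ i → ¬ (f i ≈ + 0)) →
                          (∀ {i j} → f i ≈ f j → i ≡ j) → n < p
  card-nonzero-residues {n} f f≉0 f-injective = ℕₚ.≰⇒> p≰n
    where
    r : Fin n → ℕ
    r i = residue (f i)

    r≢0 : ∀ i → ℕ.NonZero (r i)
    r≢0 i = ℕ.≢-nonZero (λ r≡0 → f≉0 i (residue≡0⇒≈0 (f i) r≡0))

    code : Fin n → Fin (ℕ.pred p)
    code i = fromℕ< (ℕₚ.pred-mono-< {{r≢0 i}} (residue<p (f i)))

    decode : ∀ {i j} → code i ≡ code j → f i ≈ f j
    decode {i} {j} same = begin
      f i           ≈⟨ residue≈ (f i) ⟨
      + r i         ≡⟨ cong +_ r≡ ⟩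
      + r j         ≈⟨ residue≈ (f j) ⟩
      f j           ∎
      where
      open ≈-Reasoning
      pred-r≡ : ℕ.pred (r i) ≡ ℕ.pred (r j)
      pred-r≡ = trans (sym (Finₚ.toℕ-fromℕ< _)) (trans (cong toℕ same) (Finₚ.toℕ-fromℕ< _))
      r≡ : r i ≡ r j
      r≡ = trans (sym (ℕₚ.suc-pred (r i) {{r≢0 i}})) (trans (cong suc pred-r≡) (ℕₚ.suc-pred (r j) {{r≢0 j}}))

    pred[p]<p : ℕ.pred p < p
    pred[p]<p = subst (ℕ.pred p <_) (ℕₚ.suc-pred p) (ℕₚ.n<1+n (ℕ.pred p))

    p≰n : ¬ (p ≤ n)
    p≰n p≤n = collision (Finₚ.pigeonhole (ℕₚ.<-≤-trans pred[p]<p p≤n) code)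
      where
      collision : (∃ λ i → ∃ λ j → i Fin.< j × code i ≡ code j) → ⊥
      collision (i , j , i<j , same) = Finₚ.<-irrefl (f-injective (decode {i} {j} same)) i<j

  x²≈y²⇒x≈±y : ∀ {x y} → x * x ≈ y * y → x ≈ y ⊎ x ≈ - y
  x²≈y²⇒x≈±y {x} {y} e =
    Sum.map a-b≈0⇒a≈b (λ x+y≈0 → a-b≈0⇒a≈b (≈-trans (≈-reflexive (minus-neg x y)) x+y≈0))
      (x*y≈0⇒x≈0⊎y≈0 (≈-trans (≈-reflexive (difference-of-squares x y)) (a≈b⇒a-b≈0 e)))
    where
    difference-of-squares : ∀ x y → (x - y) * (x + y) ≡ x * x - y * y
    difference-of-squares = solve-∀
    minus-neg : ∀ x y → x - - y ≡ x + y
    minus-neg = solve-∀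

  *-cancelˡ-≈ : ∀ {c x y} → ¬ (c ≈ + 0) → c * x ≈ c * y → x ≈ y
  *-cancelˡ-≈ {c} {x} {y} c≉0 e =
    a-b≈0⇒a≈b (x*y≈0⇒y≈0 c≉0 (≈-trans (≈-reflexive (distrib c x y)) (a≈b⇒a-b≈0 e)))
    where
    distrib : ∀ c x y → c * (x - y) ≡ c * x - c * y
    distrib = solve-∀

  Square-of-ratio : ∀ {a x y} → ¬ (y ≈ + 0) → x * x ≈ a * (y * y) → Square a
  Square-of-ratio {a} {x} {y} y≉0 e with inverse y≉0
  ... | w , yw≈1 = x * w , (begin
    (x * w) * (x * w)          ≡⟨ interchange x w ⟩
    (x * x) * (w * w)          ≈⟨ *-congʳ (w * w) e ⟩
    a * (y * y) * (w * w)      ≡⟨ regroup a y w ⟩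
    a * ((y * w) * (y * w))    ≈⟨ *-congˡ a (*-cong yw≈1 yw≈1) ⟩
    a * (+ 1 * + 1)            ≡⟨ ℤₚ.*-identityʳ a ⟩
    a                          ∎)
    where
    open ≈-Reasoning
    interchange : ∀ x w → (x * w) * (x * w) ≡ (x * x) * (w * w)
    interchange = solve-∀
    regroup : ∀ a y w → a * (y * y) * (w * w) ≡ a * ((y * w) * (y * w))
    regroup = solve-∀

  nonsquare⇒≉0 : ∀ {a} → ¬ Square a → ¬ (a ≈ + 0)
  nonsquare⇒≉0 ¬□a a≈0 = ¬□a (+ 0 , ≈-sym a≈0)

  +x²≈+y²⇒x≡y : ∀ {x y} → 0 < x ℕ.+ y → x ℕ.+ y < p → + x * + x ≈ + y * + y → x ≡ y
  +x²≈+y²⇒x≡y {x} {y} 0<x+y x+y<p e = [ +-injective-below x<p y<p , ⊥-elim ∘ x≉-y ]′ (x²≈y²⇒x≈±y e)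
    where
    x<p = ℕₚ.≤-<-trans (ℕₚ.m≤m+n x y) x+y<p
    y<p = ℕₚ.≤-<-trans (ℕₚ.m≤n+m y x) x+y<p
    x≉-y : ¬ (+ x ≈ - + y)
    x≉-y x≈-y = +n≉0 0<x+y x+y<p (begin
      + (x ℕ.+ y)    ≡⟨ ℤₚ.pos-+ x y ⟩
      + x + + y      ≈⟨ +-congʳ (+ y) x≈-y ⟩
      - + y + + y    ≡⟨ ℤₚ.+-inverseˡ (+ y) ⟩
      + 0            ∎)
      where open ≈-Reasoning

  private
    module HalfSquares (m : ℕ) (p≡1+2m : p ≡ suc (m ℕ.+ m)) {a} (¬□a : ¬ Square a) where

      1+k<p : ∀ (k : Fin m) → suc (toℕ k) < p
      1+k<p k = subst (suc (toℕ k) <_) (sym p≡1+2m) (s<s (ℕₚ.≤-trans (Finₚ.toℕ<n k) (ℕₚ.m≤m+n m m)))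

      square : Fin m → ℤ
      square k = + suc (toℕ k) * + suc (toℕ k)

      1+k≉0 : ∀ k → ¬ (+ suc (toℕ k) ≈ + 0)
      1+k≉0 k = +n≉0 z<s (1+k<p k)

      square≉0 : ∀ k → ¬ (square k ≈ + 0)
      square≉0 k = *-≉0 (1+k≉0 k) (1+k≉0 k)

      square-injective : ∀ {k l} → square k ≈ square l → k ≡ l
      square-injective {k} {l} e = Finₚ.toℕ-injective (ℕₚ.suc-injective (+x²≈+y²⇒x≡y z<s sum<p e))
        where
        sum<p : suc (toℕ k) ℕ.+ suc (toℕ l) < p
        sum<p = subst (suc (toℕ k) ℕ.+ suc (toℕ l) <_) (sym p≡1+2m)
                  (s≤s (ℕₚ.+-mono-≤ (Finₚ.toℕ<n k) (Finₚ.toℕ<n l)))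

      squares-and-multiples : Fin m ⊎ Fin m → ℤ
      squares-and-multiples (inj₁ k) = square k
      squares-and-multiples (inj₂ k) = a * square k

      squares-and-multiples≉0 : ∀ x → ¬ (squares-and-multiples x ≈ + 0)
      squares-and-multiples≉0 (inj₁ k) = square≉0 k
      squares-and-multiples≉0 (inj₂ k) = *-≉0 (nonsquare⇒≉0 ¬□a) (square≉0 k)

      squares-and-multiples-injective : ∀ {x y} → squares-and-multiples x ≈ squares-and-multiples y → x ≡ y
      squares-and-multiples-injective {inj₁ k} {inj₁ l} e = cong inj₁ (square-injective e)
      squares-and-multiples-injective {inj₁ k} {inj₂ l} e =
        ⊥-elim (¬□a (Square-of-ratio {x = + suc (toℕ k)} (1+k≉0 l) e))
      squares-and-multiples-injective {inj₂ k} {inj₁ l} e =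
        ⊥-elim (¬□a (Square-of-ratio {x = + suc (toℕ l)} (1+k≉0 k) (≈-sym e)))
      squares-and-multiples-injective {inj₂ k} {inj₂ l} e =
        cong inj₂ (square-injective (*-cancelˡ-≈ (nonsquare⇒≉0 ¬□a) e))

  -- Otherwise 1², …, m², a·1², …, a·m² and b would be p distinct nonzero residues (p = 2m + 1).
  nonsquare*nonsquare : 2 < p → ∀ {a b} → ¬ Square a → ¬ Square b → ¬ ¬ Square (a * b)
  nonsquare*nonsquare 2<p {a} {b} ¬□a ¬□b ¬□ab with odd-prime p-prime 2<p
  ... | m , p≡1+2m = ℕₚ.<-irrefl (sym p≡1+2m) (card-nonzero-residues f f≉0 f-injective)
    where
    open HalfSquares m p≡1+2m ¬□a

    b≉squares-and-multiples : ∀ x → ¬ (b ≈ squares-and-multiples x)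
    b≉squares-and-multiples (inj₁ k) e = ¬□b (+ suc (toℕ k) , ≈-sym e)
    b≉squares-and-multiples (inj₂ k) e = ¬□ab (a * + suc (toℕ k) , (begin
      (a * n) * (a * n)      ≡⟨ regroup a n ⟩
      a * (a * (n * n))      ≈⟨ *-congˡ a e ⟨
      a * b                  ∎))
      where
      open ≈-Reasoning
      n = + suc (toℕ k)
      regroup : ∀ a n → (a * n) * (a * n) ≡ a * (a * (n * n))
      regroup = solve-∀

    f : Fin (suc (m ℕ.+ m)) → ℤ
    f Fin.zero    = b
    f (Fin.suc i) = squares-and-multiples (splitAt m i)

    f≉0 : ∀ i → ¬ (f i ≈ + 0)
    f≉0 Fin.zero    = nonsquare⇒≉0 ¬□b
    f≉0 (Fin.suc i) = squares-and-multiples≉0 (splitAt m i)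

    f-injective : ∀ {i j} → f i ≈ f j → i ≡ j
    f-injective {Fin.zero}  {Fin.zero}  _ = refl
    f-injective {Fin.zero}  {Fin.suc j} e = ⊥-elim (b≉squares-and-multiples (splitAt m j) e)
    f-injective {Fin.suc i} {Fin.zero}  e = ⊥-elim (b≉squares-and-multiples (splitAt m i) (≈-sym e))
    f-injective {Fin.suc i} {Fin.suc j} e = cong Fin.suc (begin
      i                         ≡⟨ Finₚ.join-splitAt m m i ⟨
      join m m (splitAt m i)    ≡⟨ cong (join m m) (squares-and-multiples-injective {splitAt m i} {splitAt m j} e) ⟩
      join m m (splitAt m j)    ≡⟨ Finₚ.join-splitAt m m j ⟩
      j                         ∎)
      where open ≡-Reasoning

eval : ℤ → Poly → ℤ
eval x []      = + 0
eval x (c ∷ f) = c + x * eval x f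

-- Since (c + y f)' = f + y f', this is the formal derivative evaluated at x.
deriv : ℤ → Poly → ℤ
deriv x []      = + 0
deriv x (c ∷ f) = eval x f + x * deriv x f

eval-+P : ∀ x f g → eval x (f +P g) ≡ eval x f + eval x g
eval-+P x []      g       = sym (ℤₚ.+-identityˡ (eval x g))
eval-+P x (a ∷ f) []      = sym (ℤₚ.+-identityʳ (eval x (a ∷ f)))
eval-+P x (a ∷ f) (b ∷ g) = begin
  (a + b) + x * eval x (f +P g)            ≡⟨ cong (λ z → (a + b) + x * z) (eval-+P x f g) ⟩
  (a + b) + x * (eval x f + eval x g)      ≡⟨ regroup a b x (eval x f) (eval x g) ⟩
  (a + x * eval x f) + (b + x * eval x g)  ∎
  where
  open ≡-Reasoning
  regroup : ∀ a b x u v → (a + b) + x * (u + v) ≡ (a + x * u) + (b + x * v)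
  regroup = solve-∀

eval-scale : ∀ x c f → eval x (scale c f) ≡ c * eval x f
eval-scale x c []      = sym (ℤₚ.*-zeroʳ c)
eval-scale x c (a ∷ f) = trans (cong (λ z → c * a + x * z) (eval-scale x c f)) (regroup c a x (eval x f))
  where
  regroup : ∀ c a x u → c * a + x * (c * u) ≡ c * (a + x * u)
  regroup = solve-∀

eval-*P : ∀ x f g → eval x (f *P g) ≡ eval x f * eval x g
eval-*P x []      g = refl
eval-*P x (a ∷ f) g = begin
  eval x (scale a g +P (+ 0 ∷ (f *P g)))            ≡⟨ eval-+P x (scale a g) (+ 0 ∷ (f *P g)) ⟩
  eval x (scale a g) + (+ 0 + x * eval x (f *P g))
    ≡⟨ cong₂ (λ u v → u + (+ 0 + x * v)) (eval-scale x a g) (eval-*P x f g) ⟩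
  a * eval x g + (+ 0 + x * (eval x f * eval x g))  ≡⟨ regroup a x (eval x g) (eval x f) ⟩
  (a + x * eval x f) * eval x g                     ∎
  where
  open ≡-Reasoning
  regroup : ∀ a x v u → a * v + (+ 0 + x * (u * v)) ≡ (a + x * u) * v
  regroup = solve-∀

deriv-+P : ∀ x f g → deriv x (f +P g) ≡ deriv x f + deriv x g
deriv-+P x []      g       = sym (ℤₚ.+-identityˡ (deriv x g))
deriv-+P x (a ∷ f) []      = sym (ℤₚ.+-identityʳ (deriv x (a ∷ f)))
deriv-+P x (a ∷ f) (b ∷ g) = begin
  eval x (f +P g) + x * deriv x (f +P g)
    ≡⟨ cong₂ (λ u v → u + x * v) (eval-+P x f g) (deriv-+P x f g) ⟩
  (eval x f + eval x g) + x * (deriv x f + deriv x g)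
    ≡⟨ regroup x (eval x f) (eval x g) (deriv x f) (deriv x g) ⟩
  (eval x f + x * deriv x f) + (eval x g + x * deriv x g)
    ∎
  where
  open ≡-Reasoning
  regroup : ∀ x u v u′ v′ → (u + v) + x * (u′ + v′) ≡ (u + x * u′) + (v + x * v′)
  regroup = solve-∀

deriv-scale : ∀ x c f → deriv x (scale c f) ≡ c * deriv x f
deriv-scale x c []      = sym (ℤₚ.*-zeroʳ c)
deriv-scale x c (a ∷ f) =
  trans (cong₂ (λ u v → u + x * v) (eval-scale x c f) (deriv-scale x c f)) (regroup x c (eval x f) (deriv x f))
  where
  regroup : ∀ x c u u′ → c * u + x * (c * u′) ≡ c * (u + x * u′)
  regroup = solve-∀

deriv-*P : ∀ x f g → deriv x (f *P g) ≡ deriv x f * eval x g + eval x f * deriv x g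
deriv-*P x []      g = refl
deriv-*P x (a ∷ f) g = begin
  deriv x (scale a g +P (+ 0 ∷ (f *P g)))
    ≡⟨ deriv-+P x (scale a g) (+ 0 ∷ (f *P g)) ⟩
  deriv x (scale a g) + (eval x (f *P g) + x * deriv x (f *P g))
    ≡⟨ cong₂ _+_ (deriv-scale x a g) (cong₂ (λ u v → u + x * v) (eval-*P x f g) (deriv-*P x f g)) ⟩
  a * deriv x g + (eval x f * eval x g + x * (deriv x f * eval x g + eval x f * deriv x g))
    ≡⟨ regroup x a (eval x g) (deriv x g) (eval x f) (deriv x f) ⟩
  (eval x f + x * deriv x f) * eval x g + (a + x * eval x f) * deriv x g
    ∎
  where
  open ≡-Reasoning
  regroup : ∀ x a eg dg ef df → a * dg + (ef * eg + x * (df * eg + ef * dg))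
                               ≡ (ef + x * df) * eg + (a + x * ef) * dg
  regroup = solve-∀

eval-linP : ∀ a → eval a (linP a) ≡ + 0
eval-linP = horner
  where
  horner : ∀ a → - a + a * (+ 1 + a * + 0) ≡ + 0
  horner = solve-∀

coeff-+P : ∀ f g i → coeff (f +P g) i ≡ coeff f i + coeff g i
coeff-+P []      g       i       = sym (ℤₚ.+-identityˡ (coeff g i))
coeff-+P (a ∷ f) []      i       = sym (ℤₚ.+-identityʳ (coeff (a ∷ f) i))
coeff-+P (a ∷ f) (b ∷ g) zero    = refl
coeff-+P (a ∷ f) (b ∷ g) (suc i) = coeff-+P f g i

coeff-scale : ∀ c f i → coeff (scale c f) i ≡ c * coeff f i
coeff-scale c []      i       = sym (ℤₚ.*-zeroʳ c)
coeff-scale c (a ∷ f) zero    = refl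
coeff-scale c (a ∷ f) (suc i) = coeff-scale c f i

coeff-*P-linear : ∀ c d g i → coeff ((c ∷ d ∷ []) *P g) i ≡ c * coeff g i + d * coeff (+ 0 ∷ g) i
coeff-*P-linear c d g zero =
  trans (coeff-+P (scale c g) _ 0) (trans (cong (_+ + 0) (coeff-scale c g 0)) (regroup c d (coeff g 0)))
  where
  regroup : ∀ c d x → c * x + + 0 ≡ c * x + d * + 0
  regroup = solve-∀
coeff-*P-linear c d g (suc i) = begin
  coeff (scale c g +P (+ 0 ∷ (scale d g +P (+ 0 ∷ [])))) (suc i)
    ≡⟨ coeff-+P (scale c g) _ (suc i) ⟩
  coeff (scale c g) (suc i) + coeff (scale d g +P (+ 0 ∷ [])) i
    ≡⟨ cong₂ _+_ (coeff-scale c g (suc i)) (coeff-+P (scale d g) (+ 0 ∷ []) i) ⟩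
  c * coeff g (suc i) + (coeff (scale d g) i + coeff (+ 0 ∷ []) i)
    ≡⟨ cong (λ z → c * coeff g (suc i) + z) (cong₂ _+_ (coeff-scale d g i) (coeff-0∷[] i)) ⟩
  c * coeff g (suc i) + (d * coeff g i + + 0)
    ≡⟨ cong (λ z → c * coeff g (suc i) + z) (ℤₚ.+-identityʳ (d * coeff g i)) ⟩
  c * coeff g (suc i) + d * coeff g i
    ∎
  where
  open ≡-Reasoning
  coeff-0∷[] : ∀ i → coeff (+ 0 ∷ []) i ≡ + 0
  coeff-0∷[] zero    = refl
  coeff-0∷[] (suc i) = refl

-- Synthetic division: f = (y - a) · quotient a f + eval a f.
quotient : ℤ → Poly → Poly
quotient a []      = []
quotient a (c ∷ f) = eval a f ∷ quotient a f

coeff-quotient : ∀ a f i → coeff f i ≡ coeff (eval a f ∷ quotient a f) i - a * coeff (quotient a f) i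
coeff-quotient a []      zero    = sym (cong (λ z → + 0 - z) (ℤₚ.*-zeroʳ a))
coeff-quotient a []      (suc i) = sym (cong (λ z → + 0 - z) (ℤₚ.*-zeroʳ a))
coeff-quotient a (c ∷ f) zero    = regroup c a (eval a f)
  where
  regroup : ∀ c a e → c ≡ (c + a * e) - a * e
  regroup = solve-∀
coeff-quotient a (c ∷ f) (suc i) = coeff-quotient a f i

eval-linP-*P : ∀ a g → eval a (linP a *P g) ≡ + 0
eval-linP-*P a g = trans (eval-*P a (linP a) g) (cong (_* eval a g) (eval-linP a))

deriv-linP²-*P : ∀ a g → deriv a (linP a *P (linP a *P g)) ≡ + 0
deriv-linP²-*P a g = begin
  deriv a (linP a *P (linP a *P g))
    ≡⟨ deriv-*P a (linP a) (linP a *P g) ⟩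
  deriv a (linP a) * eval a (linP a *P g) + eval a (linP a) * deriv a (linP a *P g)
    ≡⟨ cong₂ (λ u v → deriv a (linP a) * u + v * deriv a (linP a *P g)) (eval-linP-*P a g) (eval-linP a) ⟩
  deriv a (linP a) * + 0 + + 0 * deriv a (linP a *P g)
    ≡⟨ ℤₚ.+-identityʳ (deriv a (linP a) * + 0) ⟩
  deriv a (linP a) * + 0
    ≡⟨ ℤₚ.*-zeroʳ (deriv a (linP a)) ⟩
  + 0
    ∎
  where open ≡-Reasoning

module PolynomialsModP (p : ℕ) where

  open Congruence p

  eval-≈0 : ∀ x f → (∀ i → coeff f i ≈ + 0) → eval x f ≈ + 0
  eval-≈0 x []      h = ≈-refl
  eval-≈0 x (c ∷ f) h = +-cong (h 0) (*-≈0ʳ x (eval-≈0 x f (h ∘ suc)))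

  eval-≡P : ∀ x {f g} → f ≡P g [mod p ] → eval x f ≈ eval x g
  eval-≡P x {[]}    {g}     h = ≈-sym (eval-≈0 x g (λ i → ≈-sym (≡[mod]⇒≈ (h i))))
  eval-≡P x {f}     {[]}    h = eval-≈0 x f (λ i → ≡[mod]⇒≈ (h i))
  eval-≡P x {a ∷ f} {b ∷ g} h = +-cong (≡[mod]⇒≈ {a} {b} (h 0)) (*-congˡ x (eval-≡P x {f} {g} (h ∘ suc)))

  deriv-≈0 : ∀ x f → (∀ i → coeff f i ≈ + 0) → deriv x f ≈ + 0
  deriv-≈0 x []      h = ≈-refl
  deriv-≈0 x (c ∷ f) h = +-cong (eval-≈0 x f (h ∘ suc)) (*-≈0ʳ x (deriv-≈0 x f (h ∘ suc)))

  deriv-≡P : ∀ x {f g} → f ≡P g [mod p ] → deriv x f ≈ deriv x g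
  deriv-≡P x {[]}    {g}     h = ≈-sym (deriv-≈0 x g (λ i → ≈-sym (≡[mod]⇒≈ (h i))))
  deriv-≡P x {f}     {[]}    h = deriv-≈0 x f (λ i → ≡[mod]⇒≈ (h i))
  deriv-≡P x {a ∷ f} {b ∷ g} h = +-cong (eval-≡P x {f} {g} (h ∘ suc)) (*-congˡ x (deriv-≡P x {f} {g} (h ∘ suc)))

  eval-≈ : ∀ f {x y} → x ≈ y → eval x f ≈ eval y f
  eval-≈ []      e = ≈-refl
  eval-≈ (c ∷ f) e = +-congˡ c (*-cong e (eval-≈ f e))

  factor-theorem : ∀ a f → eval a f ≈ + 0 → DividesP p (linP a ^P 1) f
  -- linP a ^P 1 unfolds to (- a * + 1 + + 0) ∷ + 1 ∷ [].
  factor-theorem a f root = q , λ i → ≈⇒≡[mod] (begin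
    coeff f i                                                   ≡⟨ coeff-quotient a f i ⟩
    coeff (eval a f ∷ q) i - a * coeff q i                      ≈⟨ sub-cong (head≈0 i) (≈-refl {a * coeff q i}) ⟩
    coeff (+ 0 ∷ q) i - a * coeff q i                           ≡⟨ regroup a (coeff q i) (coeff (+ 0 ∷ q) i) ⟩
    (- a * + 1 + + 0) * coeff q i + + 1 * coeff (+ 0 ∷ q) i     ≡⟨ coeff-*P-linear (- a * + 1 + + 0) (+ 1) q i ⟨
    coeff ((linP a ^P 1) *P q) i                                ∎)
    where
    open ≈-Reasoning
    q = quotient a f
    head≈0 : ∀ i → coeff (eval a f ∷ q) i ≈ coeff (+ 0 ∷ q) i
    head≈0 zero    = root
    head≈0 (suc i) = ≈-refl
    regroup : ∀ a u v → v - a * u ≡ (- a * + 1 + + 0) * u + + 1 * v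
    regroup = solve-∀

  non-root⇒multiplicity≡0 : ∀ {f a m} → ¬ (eval a f ≈ + 0) → IsMultiplicity p f a m → m ≡ 0
  non-root⇒multiplicity≡0 {m = zero}  _      _             = refl
  non-root⇒multiplicity≡0 {f} {a} {suc k} ¬root ((q , f≡) , _) = ⊥-elim (¬root (begin
    eval a f                                    ≈⟨ eval-≡P a {f} {(linP a *P (linP a ^P k)) *P q} f≡ ⟩
    eval a ((linP a *P (linP a ^P k)) *P q)     ≡⟨ eval-*P a (linP a *P (linP a ^P k)) q ⟩
    eval a (linP a *P (linP a ^P k)) * eval a q ≡⟨ cong (_* eval a q) (eval-linP-*P a (linP a ^P k)) ⟩
    + 0                                         ∎))
    where open ≈-Reasoning

  simple-root⇒multiplicity≡1 : ∀ {f a m} → eval a f ≈ + 0 → ¬ (deriv a f ≈ + 0) →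
                                IsMultiplicity p f a m → m ≡ 1
  simple-root⇒multiplicity≡1 {f} {a} {zero}          root _       (_ , ∤f) = ⊥-elim (∤f (factor-theorem a f root))
  simple-root⇒multiplicity≡1         {m = suc zero}  _    _       _        = refl
  simple-root⇒multiplicity≡1 {f} {a} {suc (suc k)}   _    simple ((q , f≡) , _) = ⊥-elim (simple (begin
    deriv a f                              ≈⟨ deriv-≡P a {f} {l² *P q} f≡ ⟩
    deriv a (l² *P q)                      ≡⟨ deriv-*P a l² q ⟩
    deriv a l² * eval a q + eval a l² * deriv a q
      ≡⟨ cong₂ (λ u v → u * eval a q + v * deriv a q)
               (deriv-linP²-*P a (linP a ^P k)) (eval-linP-*P a (linP a *P (linP a ^P k))) ⟩
    + 0                                    ∎))
    where
    open ≈-Reasoning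
    l² = linP a *P (linP a *P (linP a ^P k))

indicator : ℕ → ℕ → ℕ
indicator i c = if i ℕ.≡ᵇ c then 1 else 0

indicator-refl : ∀ i → indicator i i ≡ 1
indicator-refl zero    = refl
indicator-refl (suc i) = indicator-refl i

indicator-≢ : ∀ {i c} → i ≢ c → indicator i c ≡ 0
indicator-≢ {zero}  {zero}  i≢c = ⊥-elim (i≢c refl)
indicator-≢ {zero}  {suc c} _   = refl
indicator-≢ {suc i} {zero}  _   = refl
indicator-≢ {suc i} {suc c} i≢c = indicator-≢ (i≢c ∘ cong suc)

occurrences : ℕ → List ℕ → ℕ
occurrences i []       = 0
occurrences i (c ∷ cs) = indicator i c ℕ.+ occurrences i cs

sum-applyUpTo-cong : ∀ {f g} n → (∀ {i} → i < n → f i ≡ g i) → sum (applyUpTo f n) ≡ sum (applyUpTo g n)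
sum-applyUpTo-cong zero    _   = refl
sum-applyUpTo-cong (suc n) f≗g = cong₂ ℕ._+_ (f≗g z<s) (sum-applyUpTo-cong n (f≗g ∘ s<s))

sum-applyUpTo-+ : ∀ f g n → sum (applyUpTo (λ i → f i ℕ.+ g i) n) ≡ sum (applyUpTo f n) ℕ.+ sum (applyUpTo g n)
sum-applyUpTo-+ f g zero    = refl
sum-applyUpTo-+ f g (suc n) = begin
  f 0 ℕ.+ g 0 ℕ.+ sum (applyUpTo (λ i → f (suc i) ℕ.+ g (suc i)) n)
    ≡⟨ cong (f 0 ℕ.+ g 0 ℕ.+_) (sum-applyUpTo-+ (f ∘ suc) (g ∘ suc) n) ⟩
  f 0 ℕ.+ g 0 ℕ.+ (sum (applyUpTo (f ∘ suc) n) ℕ.+ sum (applyUpTo (g ∘ suc) n))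
    ≡⟨ ℕ-+.interchange (f 0) (g 0) _ _ ⟩
  f 0 ℕ.+ sum (applyUpTo (f ∘ suc) n) ℕ.+ (g 0 ℕ.+ sum (applyUpTo (g ∘ suc) n))
    ∎
  where open ≡-Reasoning

sum-applyUpTo-0 : ∀ n → sum (applyUpTo (λ _ → 0) n) ≡ 0
sum-applyUpTo-0 zero    = refl
sum-applyUpTo-0 (suc n) = sum-applyUpTo-0 n

sum-applyUpTo-indicator : ∀ {c n} → c < n → sum (applyUpTo (λ i → indicator i c) n) ≡ 1
sum-applyUpTo-indicator {zero}  {suc n} _         = cong suc (sum-applyUpTo-0 n)
sum-applyUpTo-indicator {suc c} {suc n} (s<s c<n) = sum-applyUpTo-indicator c<n

sum-applyUpTo-occurrences : ∀ {n} cs → All (_< n) cs → sum (applyUpTo (λ i → occurrences i cs) n) ≡ length cs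
sum-applyUpTo-occurrences {n} []       []           = sum-applyUpTo-0 n
sum-applyUpTo-occurrences {n} (c ∷ cs) (c<n ∷ cs<n) = begin
  sum (applyUpTo (λ i → indicator i c ℕ.+ occurrences i cs) n)
    ≡⟨ sum-applyUpTo-+ (λ i → indicator i c) (λ i → occurrences i cs) n ⟩
  sum (applyUpTo (λ i → indicator i c) n) ℕ.+ sum (applyUpTo (λ i → occurrences i cs) n)
    ≡⟨ cong₂ ℕ._+_ (sum-applyUpTo-indicator c<n) (sum-applyUpTo-occurrences cs cs<n) ⟩
  suc (length cs)
    ∎
  where open ≡-Reasoning

module RootCounting (p : ℕ) (p-prime : Prime p) where

  open Congruence p
  open PrimeField p p-prime
  open PolynomialsModP p

  indicator-residue-≈ : ∀ {i a} → i < p → + i ≈ a → indicator i (residue a) ≡ 1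
  indicator-residue-≈ {i} {a} i<p i≈a = subst (λ c → indicator i c ≡ 1)
    (+-injective-below i<p (residue<p a) (≈-trans i≈a (≈-sym (residue≈ a)))) (indicator-refl i)

  indicator-residue-≉ : ∀ {i a} → ¬ (+ i ≈ a) → indicator i (residue a) ≡ 0
  indicator-residue-≉ {i} {a} i≉a = indicator-≢ (λ i≡r → i≉a (≈-trans (≈-reflexive (cong +_ i≡r)) (residue≈ a)))

  occurrences-≡0 : ∀ {i} as → All (λ a → ¬ (+ i ≈ a)) as → occurrences i (map residue as) ≡ 0
  occurrences-≡0 []       []           = refl
  occurrences-≡0 (a ∷ as) (i≉a ∷ i≉as) = cong₂ ℕ._+_ (indicator-residue-≉ i≉a) (occurrences-≡0 as i≉as)

  occurrences-≡1 : ∀ {i} as → i < p → AllPairs (λ a b → ¬ (a ≈ b)) as → Any (λ a → + i ≈ a) as →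
                   occurrences i (map residue as) ≡ 1
  occurrences-≡1 (a ∷ as) i<p (a≉as ∷ _) (here i≈a) =
    cong₂ ℕ._+_ (indicator-residue-≈ i<p i≈a)
                (occurrences-≡0 as (All.map (λ a≉b i≈b → a≉b (≈-trans (≈-sym i≈a) i≈b)) a≉as))
  occurrences-≡1 (a ∷ as) i<p (a≉as ∷ distinct) (there i∈as) =
    cong₂ ℕ._+_ (indicator-residue-≉ i≉a) (occurrences-≡1 as i<p distinct i∈as)
    where
    i≉a : ¬ (+ _ ≈ a)
    i≉a i≈a = All.lookupWith (λ a≉b i≈b → a≉b (≈-trans (≈-sym i≈a) i≈b)) a≉as i∈as

  simple-roots⇒RootCountIs : ∀ f (roots : List ℤ) →
    All (λ a → eval a f ≈ + 0) roots → AllPairs (λ a b → ¬ (a ≈ b)) roots →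
    (∀ {y} → eval y f ≈ + 0 → Any (y ≈_) roots) → (∀ {y} → eval y f ≈ + 0 → ¬ (deriv y f ≈ + 0)) →
    RootCountIs p f (length roots)
  simple-roots⇒RootCountIs f roots are-roots distinct complete simple mult is-mult = begin
    sum (map mult (upTo p))                                        ≡⟨ cong sum (map-upTo mult p) ⟩
    sum (applyUpTo mult p)                                         ≡⟨ sum-applyUpTo-cong p mult≡occurrences ⟩
    sum (applyUpTo (λ i → occurrences i (map residue roots)) p)
      ≡⟨ sum-applyUpTo-occurrences (map residue roots) (map⁺ (All.universal residue<p roots)) ⟩
    length (map residue roots)                                     ≡⟨ length-map residue roots ⟩
    length roots                                                   ∎
    where
    open ≡-Reasoning
    mult≡occurrences : ∀ {i} → i < p → mult i ≡ occurrences i (map residue roots)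
    mult≡occurrences {i} i<p = by-cases (≈0? (eval (+ i) f))
      where
      by-cases : Dec (eval (+ i) f ≈ + 0) → mult i ≡ occurrences i (map residue roots)
      by-cases (yes root) = trans (simple-root⇒multiplicity≡1 {f} root (simple root) (is-mult i i<p))
                           (sym (occurrences-≡1 roots i<p distinct (complete root)))
      by-cases (no ¬root) = trans (non-root⇒multiplicity≡0 {f} ¬root (is-mult i i<p))
                           (sym (occurrences-≡0 roots (All.map (λ a-root i≈a → ¬root (≈-trans (eval-≈ f i≈a) a-root))
                                                               are-roots)))

-- The ring solver does not unfold definitions, so each identity below is proved in unfolded form.

W : ℤ → ℤ → ℤ
W κ y = + 2 * κ - + 2 * y * y + + 3 * y - + 6

P : ℤ → ℤ → ℤ → ℤ
P κ r y = + 2 * y * y - (+ 3 - r) * y - + 2 * κ + + 6 - + 2 * r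

T : ℤ → ℤ → ℤ
T r y = + 4 * y - + 3 + r

E : ℤ → ℤ → ℤ
E κ r = + 16 * κ - + 34 + + 10 * r

A : ℤ → ℤ
A κ = + 8 * κ - + 17

4B≡W²-5[y-2]² : ∀ κ y → + 4 * eval y (B₂ κ) ≡ W κ y * W κ y - + 5 * ((y - + 2) * (y - + 2))
4B≡W²-5[y-2]² = identity
  where
  identity : ∀ k y → + 4 * ((k * k - + 6 * k + + 4) + y * ((+ 3 * k - + 4) + y * ((- (+ 2 * k - + 7))
                       + y * ((- (+ 3)) + y * (+ 1 + y * + 0)))))
                     ≡ (+ 2 * k - + 2 * y * y + + 3 * y - + 6) * (+ 2 * k - + 2 * y * y + + 3 * y - + 6)
                       - + 5 * ((y - + 2) * (y - + 2))
  identity = solve-∀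

4B≡P₊P₋ : ∀ κ r y → + 4 * eval y (B₂ κ) ≡ P κ r y * P κ (- r) y + (r * r - + 5) * ((y - + 2) * (y - + 2))
4B≡P₊P₋ = identity
  where
  identity : ∀ k r y → + 4 * ((k * k - + 6 * k + + 4) + y * ((+ 3 * k - + 4) + y * ((- (+ 2 * k - + 7))
                         + y * ((- (+ 3)) + y * (+ 1 + y * + 0)))))
                       ≡ (+ 2 * y * y - (+ 3 - r) * y - + 2 * k + + 6 - + 2 * r)
                         * (+ 2 * y * y - (+ 3 - (- r)) * y - + 2 * k + + 6 - + 2 * (- r))
                         + (r * r - + 5) * ((y - + 2) * (y - + 2))
  identity = solve-∀

4B′≡T₊P₋+P₊T₋ : ∀ κ r y → + 4 * deriv y (B₂ κ) ≡
                 T r y * P κ (- r) y + P κ r y * T (- r) y + (r * r - + 5) * (+ 2 * (y - + 2))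
4B′≡T₊P₋+P₊T₋ = identity
  where
  identity : ∀ k r y → + 4 * (((+ 3 * k - + 4) + y * ((- (+ 2 * k - + 7)) + y * ((- (+ 3)) + y * (+ 1 + y * + 0))))
                         + y * (((- (+ 2 * k - + 7)) + y * ((- (+ 3)) + y * (+ 1 + y * + 0)))
                         + y * (((- (+ 3)) + y * (+ 1 + y * + 0)) + y * ((+ 1 + y * + 0) + y * (+ 0 + y * + 0)))))
                       ≡ (+ 4 * y - + 3 + r) * (+ 2 * y * y - (+ 3 - (- r)) * y - + 2 * k + + 6 - + 2 * (- r))
                         + (+ 2 * y * y - (+ 3 - r) * y - + 2 * k + + 6 - + 2 * r) * (+ 4 * y - + 3 + (- r))
                         + (r * r - + 5) * (+ 2 * (y - + 2))
  identity = solve-∀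

8P≡T²-E : ∀ κ r y → + 8 * P κ r y ≡ T r y * T r y - E κ r - (r * r - + 5)
8P≡T²-E = identity
  where
  identity : ∀ k r y → + 8 * (+ 2 * y * y - (+ 3 - r) * y - + 2 * k + + 6 - + 2 * r)
                       ≡ (+ 4 * y - + 3 + r) * (+ 4 * y - + 3 + r) - (+ 16 * k - + 34 + + 10 * r) - (r * r - + 5)
  identity = solve-∀

E₊E₋≡16η : ∀ κ r → E κ r * E κ (- r) ≡ + 16 * η κ - + 100 * (r * r - + 5)
E₊E₋≡16η = identity
  where
  identity : ∀ k r → (+ 16 * k - + 34 + + 10 * r) * (+ 16 * k - + 34 + + 10 * (- r))
                     ≡ + 16 * (+ 16 * k * k - + 68 * k + + 41) - + 100 * (r * r - + 5)
  identity = solve-∀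

P₊-P₋≡2r[y-2] : ∀ κ r y → P κ r y - P κ (- r) y ≡ r * (+ 2 * (y - + 2))
P₊-P₋≡2r[y-2] = identity
  where
  identity : ∀ k r y → (+ 2 * y * y - (+ 3 - r) * y - + 2 * k + + 6 - + 2 * r)
                       - (+ 2 * y * y - (+ 3 - (- r)) * y - + 2 * k + + 6 - + 2 * (- r))
                       ≡ r * (+ 2 * (y - + 2))
  identity = solve-∀

P-expand-at-2 : ∀ κ r y → P κ r y ≡ + 2 * (+ 4 - κ) + (y - + 2) * (+ 2 * y + + 1 + r)
P-expand-at-2 = identity
  where
  identity : ∀ k r y → + 2 * y * y - (+ 3 - r) * y - + 2 * k + + 6 - + 2 * r
                       ≡ + 2 * (+ 4 - k) + (y - + 2) * (+ 2 * y + + 1 + r)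
  identity = solve-∀

W-expand-at-2 : ∀ κ y → W κ y ≡ + 2 * (κ - + 4) + (y - + 2) * (- (+ 2 * y) - + 1)
W-expand-at-2 = identity
  where
  identity : ∀ k y → + 2 * k - + 2 * y * y + + 3 * y - + 6 ≡ + 2 * (k - + 4) + (y - + 2) * (- (+ 2 * y) - + 1)
  identity = solve-∀

E₊+E₋≡4A : ∀ κ r → E κ r + E κ (- r) ≡ + 4 * A κ
E₊+E₋≡4A = identity
  where
  identity : ∀ k r → (+ 16 * k - + 34 + + 10 * r) + (+ 16 * k - + 34 + + 10 * (- r)) ≡ + 4 * (+ 8 * k - + 17)
  identity = solve-∀

E₊-E₋≡20r : ∀ κ r → E κ r - E κ (- r) ≡ + 20 * r
E₊-E₋≡20r = identity
  where
  identity : ∀ k r → (+ 16 * k - + 34 + + 10 * r) - (+ 16 * k - + 34 + + 10 * (- r)) ≡ + 20 * r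
  identity = solve-∀

A²-4η≡125 : ∀ κ → A κ * A κ - + 4 * η κ ≡ + 125
A²-4η≡125 = identity
  where
  identity : ∀ k → (+ 8 * k - + 17) * (+ 8 * k - + 17) - + 4 * (+ 16 * k * k - + 68 * k + + 41) ≡ + 125
  identity = solve-∀

module B₂Roots (p : ℕ) (p-prime : Prime p) (3<p : 3 < p) (κ : ℤ) (κ≉4 : ¬ Congruence._≈_ p κ (+ 4))
               (η≉0 : ¬ Congruence._≈_ p (η κ) (+ 0)) (5≉0 : ¬ Congruence._≈_ p (+ 5) (+ 0)) where

  open Congruence p
  open PrimeField p p-prime
  open PolynomialsModP p
  open RootCounting p p-prime

  Root : ℤ → Set
  Root y = eval y (B₂ κ) ≈ + 0

  -- A record so that r can be inferred from a proof of √5 r.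
  record √5 (r : ℤ) : Set where
    constructor √5-intro
    field r²≈5 : r * r ≈ + 5

  open √5

  2≉0 : ¬ (+ 2 ≈ + 0)
  2≉0 = +n≉0 (s≤s z≤n) (ℕₚ.<-trans (s≤s (s≤s (s≤s z≤n))) 3<p)

  4≉0 : ¬ (+ 4 ≈ + 0)
  4≉0 = *-≉0 2≉0 2≉0

  16≉0 : ¬ (+ 16 ≈ + 0)
  16≉0 = *-≉0 4≉0 4≉0

  √5-neg : ∀ {r} → √5 r → √5 (- r)
  √5-neg {r} √5r = √5-intro (≈-trans (≈-reflexive (neg-square r)) (r²≈5 √5r))
    where
    neg-square : ∀ r → - r * - r ≡ r * r
    neg-square = solve-∀

  √5≉0 : ∀ {r} → √5 r → ¬ (r ≈ + 0)
  √5≉0 {r} √5r r≈0 = 5≉0 (≈-trans (≈-sym (r²≈5 √5r)) (*-≈0ˡ r r≈0))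

  r²-5≈0 : ∀ {r} → √5 r → r * r - + 5 ≈ + 0
  r²-5≈0 √5r = a≈b⇒a-b≈0 (r²≈5 √5r)

  root⇒√5 : ∀ y → Root y → ∃ √5
  root⇒√5 y root = by-cases (≈0? (y - + 2))
    where
    W²≈5[y-2]² : W κ y * W κ y ≈ + 5 * ((y - + 2) * (y - + 2))
    W²≈5[y-2]² = a-b≈0⇒a≈b (≈-trans (≈-reflexive (sym (4B≡W²-5[y-2]² κ y))) (*-≈0ʳ (+ 4) root))
    by-cases : Dec (y - + 2 ≈ + 0) → ∃ √5
    by-cases (no y≉2)  = map₂ √5-intro (Square-of-ratio {x = W κ y} y≉2 W²≈5[y-2]²)
    by-cases (yes y≈2) = ⊥-elim (κ≉4 (a-b≈0⇒a≈b (x*y≈0⇒y≈0 2≉0 (begin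
      + 2 * (κ - + 4)                                     ≈⟨ x+z≈x (+ 2 * (κ - + 4)) (*-≈0ˡ (- (+ 2 * y) - + 1) y≈2) ⟨
      + 2 * (κ - + 4) + (y - + 2) * (- (+ 2 * y) - + 1)   ≡⟨ W-expand-at-2 κ y ⟨
      W κ y                                               ≈⟨ x*x≈0⇒x≈0 W²≈0 ⟩
      + 0                                                 ∎))))
      where
      open ≈-Reasoning
      W²≈0 : W κ y * W κ y ≈ + 0
      W²≈0 = ≈-trans W²≈5[y-2]² (*-≈0ʳ (+ 5) (*-≈0ˡ (y - + 2) y≈2))

  4B≈P₊P₋ : ∀ {r} y → √5 r → + 4 * eval y (B₂ κ) ≈ P κ r y * P κ (- r) y
  4B≈P₊P₋ {r} y √5r = ≈-trans (≈-reflexive (4B≡P₊P₋ κ r y))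
                              (x+z≈x (P κ r y * P κ (- r) y) (*-≈0ˡ ((y - + 2) * (y - + 2)) (r²-5≈0 √5r)))

  root⇒P₊⊎P₋ : ∀ {r} y → √5 r → Root y → P κ r y ≈ + 0 ⊎ P κ (- r) y ≈ + 0
  root⇒P₊⊎P₋ {r} y √5r root = x*y≈0⇒x≈0⊎y≈0 (≈-trans (≈-sym (4B≈P₊P₋ y √5r)) (*-≈0ʳ (+ 4) root))

  P≈0⇒root : ∀ {r} y → √5 r → P κ r y ≈ + 0 → Root y
  P≈0⇒root {r} y √5r P≈0 = x*y≈0⇒y≈0 4≉0 (≈-trans (4B≈P₊P₋ y √5r) (*-≈0ˡ (P κ (- r) y) P≈0))

  P₊≈0⇒P₋≉0 : ∀ {r} y → √5 r → P κ r y ≈ + 0 → ¬ (P κ (- r) y ≈ + 0)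
  P₊≈0⇒P₋≉0 {r} y √5r P₊≈0 P₋≈0 = κ≉4 (≈-sym (a-b≈0⇒a≈b (x*y≈0⇒y≈0 2≉0 (begin
    + 2 * (+ 4 - κ)                                   ≈⟨ x+z≈x (+ 2 * (+ 4 - κ)) (*-≈0ˡ (+ 2 * y + + 1 + r) y≈2) ⟨
    + 2 * (+ 4 - κ) + (y - + 2) * (+ 2 * y + + 1 + r) ≡⟨ P-expand-at-2 κ r y ⟨
    P κ r y                                           ≈⟨ P₊≈0 ⟩
    + 0                                               ∎))))
    where
    open ≈-Reasoning
    2r[y-2]≈0 : r * (+ 2 * (y - + 2)) ≈ + 0
    2r[y-2]≈0 = ≈-trans (≈-reflexive (sym (P₊-P₋≡2r[y-2] κ r y))) (sub-cong P₊≈0 P₋≈0)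
    y≈2 : y - + 2 ≈ + 0
    y≈2 = x*y≈0⇒y≈0 2≉0 (x*y≈0⇒y≈0 (√5≉0 √5r) 2r[y-2]≈0)

  E₊E₋≈16η : ∀ {r} → √5 r → E κ r * E κ (- r) ≈ + 16 * η κ
  E₊E₋≈16η {r} √5r = ≈-trans (≈-reflexive (E₊E₋≡16η κ r)) (x-z≈x (+ 16 * η κ) (*-≈0ʳ (+ 100) (r²-5≈0 √5r)))

  E≉0 : ∀ {r} → √5 r → ¬ (E κ r ≈ + 0)
  E≉0 {r} √5r E≈0 = *-≉0 16≉0 η≉0 (≈-trans (≈-sym (E₊E₋≈16η √5r)) (*-≈0ˡ (E κ (- r)) E≈0))

  8P≈T²-E : ∀ {r} y → √5 r → + 8 * P κ r y ≈ T r y * T r y - E κ r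
  8P≈T²-E {r} y √5r = ≈-trans (≈-reflexive (8P≡T²-E κ r y)) (x-z≈x (T r y * T r y - E κ r) (r²-5≈0 √5r))

  P≈0⇒T²≈E : ∀ {r} y → √5 r → P κ r y ≈ + 0 → T r y * T r y ≈ E κ r
  P≈0⇒T²≈E {r} y √5r P≈0 = a-b≈0⇒a≈b (≈-trans (≈-sym (8P≈T²-E y √5r)) (*-≈0ʳ (+ 8) P≈0))

  T²≈E⇒P≈0 : ∀ {r} y → √5 r → T r y * T r y ≈ E κ r → P κ r y ≈ + 0
  T²≈E⇒P≈0 {r} y √5r T²≈E = x*y≈0⇒y≈0 (*-≉0 2≉0 4≉0) (≈-trans (8P≈T²-E y √5r) (a≈b⇒a-b≈0 T²≈E))

  roots-simple : ∀ y → Root y → ¬ (deriv y (B₂ κ) ≈ + 0)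
  roots-simple y root = simple-for-both (root⇒√5 y root)
    where
    simple : ∀ {r} → √5 r → P κ r y ≈ + 0 → ¬ (deriv y (B₂ κ) ≈ + 0)
    simple {r} √5r P₊≈0 B′≈0 = *-≉0 T≉0 (P₊≈0⇒P₋≉0 y √5r P₊≈0) (begin
      T r y * P κ (- r) y
        ≈⟨ x+z≈x (T r y * P κ (- r) y) (*-≈0ˡ (T (- r) y) P₊≈0) ⟨
      T r y * P κ (- r) y + P κ r y * T (- r) y
        ≈⟨ x+z≈x (T r y * P κ (- r) y + P κ r y * T (- r) y) (*-≈0ˡ (+ 2 * (y - + 2)) (r²-5≈0 √5r)) ⟨
      T r y * P κ (- r) y + P κ r y * T (- r) y + (r * r - + 5) * (+ 2 * (y - + 2))
        ≡⟨ 4B′≡T₊P₋+P₊T₋ κ r y ⟨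
      + 4 * deriv y (B₂ κ)                                    ≈⟨ *-≈0ʳ (+ 4) B′≈0 ⟩
      + 0                                                     ∎)
      where
      open ≈-Reasoning
      T≉0 : ¬ (T r y ≈ + 0)
      T≉0 T≈0 = E≉0 √5r (≈-trans (≈-sym (P≈0⇒T²≈E y √5r P₊≈0)) (*-≈0ˡ (T r y) T≈0))
    simple-for-both : ∃ √5 → ¬ (deriv y (B₂ κ) ≈ + 0)
    simple-for-both (r , √5r) = [ simple √5r , simple (√5-neg √5r) ]′ (root⇒P₊⊎P₋ y √5r root)

  P-≈ : ∀ r {y y′} → y ≈ y′ → P κ r y ≈ P κ r y′
  P-≈ r e = sub-cong (+-congʳ (+ 6) (sub-cong (sub-cong (*-cong (*-congˡ (+ 2) e) e) (*-congˡ (+ 3 - r) e))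
                                              (≈-refl {+ 2 * κ})))
                     (≈-refl {+ 2 * r})

  T-≈ : ∀ r {y y′} → y ≈ y′ → T r y ≈ T r y′
  T-≈ r e = +-congʳ r (sub-cong (*-congˡ (+ 4) e) (≈-refl {+ 3}))

  q : ℤ
  q = proj₁ (inverse 4≉0)

  4q≈1 : + 4 * q ≈ + 1
  4q≈1 = proj₂ (inverse 4≉0)

  module RootsOfP {r} (√5r : √5 r) (t : ℤ) (t²≈E : t * t ≈ E κ r) where

    root-at : ℤ → ℤ
    root-at s = q * (+ 3 - r + s)

    T-root-at : ∀ s → T r (root-at s) ≈ s
    T-root-at s = begin
      + 4 * (q * (+ 3 - r + s)) - + 3 + r      ≡⟨ regroup q r s ⟩
      (+ 4 * q) * (+ 3 - r + s) - + 3 + r      ≈⟨ +-congʳ r (sub-cong (*-congʳ (+ 3 - r + s) 4q≈1) (≈-refl {+ 3})) ⟩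
      + 1 * (+ 3 - r + s) - + 3 + r            ≡⟨ simplify r s ⟩
      s                                        ∎
      where
      open ≈-Reasoning
      regroup : ∀ q r s → + 4 * (q * (+ 3 - r + s)) - + 3 + r ≡ (+ 4 * q) * (+ 3 - r + s) - + 3 + r
      regroup = solve-∀
      simplify : ∀ r s → + 1 * (+ 3 - r + s) - + 3 + r ≡ s
      simplify = solve-∀

    T≈⇒≈root-at : ∀ y {s} → T r y ≈ s → y ≈ root-at s
    T≈⇒≈root-at y {s} T≈s = begin
      y                                     ≡⟨ ℤₚ.*-identityˡ y ⟨
      + 1 * y                               ≈⟨ *-congʳ y 4q≈1 ⟨
      (+ 4 * q) * y                         ≡⟨ regroup q r y ⟩
      q * (+ 3 - r + (+ 4 * y - + 3 + r))   ≈⟨ *-congˡ q (+-congˡ (+ 3 - r) T≈s) ⟩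
      q * (+ 3 - r + s)                     ∎
      where
      open ≈-Reasoning
      regroup : ∀ q r y → (+ 4 * q) * y ≡ q * (+ 3 - r + (+ 4 * y - + 3 + r))
      regroup = solve-∀

    t≉0 : ¬ (t ≈ + 0)
    t≉0 t≈0 = E≉0 √5r (≈-trans (≈-sym t²≈E) (*-≈0ˡ t t≈0))

    y₊ y₋ : ℤ
    y₊ = root-at t
    y₋ = root-at (- t)

    P-y₊ : P κ r y₊ ≈ + 0
    P-y₊ = T²≈E⇒P≈0 y₊ √5r (≈-trans (*-cong (T-root-at t) (T-root-at t)) t²≈E)

    P-y₋ : P κ r y₋ ≈ + 0
    P-y₋ = T²≈E⇒P≈0 y₋ √5r (≈-trans (*-cong (T-root-at (- t)) (T-root-at (- t)))
                                    (≈-trans (≈-reflexive (neg-square t)) t²≈E))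
      where
      neg-square : ∀ t → - t * - t ≡ t * t
      neg-square = solve-∀

    P≈0⇒y₊⊎y₋ : ∀ y → P κ r y ≈ + 0 → y ≈ y₊ ⊎ y ≈ y₋
    P≈0⇒y₊⊎y₋ y P≈0 = Sum.map (T≈⇒≈root-at y) (T≈⇒≈root-at y)
                              (x²≈y²⇒x≈±y (≈-trans (P≈0⇒T²≈E y √5r P≈0) (≈-sym t²≈E)))

    y₊≉y₋ : ¬ (y₊ ≈ y₋)
    y₊≉y₋ y₊≈y₋ = t≉0 (x*y≈0⇒y≈0 2≉0 (≈-trans (≈-reflexive (double t))
                        (a≈b⇒a-b≈0 (≈-trans (≈-sym (T-root-at t)) (≈-trans (T-≈ r y₊≈y₋) (T-root-at (- t)))))))
      where
      double : ∀ t → + 2 * t ≡ t - - t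
      double = solve-∀

  cross-distinct : ∀ {r} → √5 r → ∀ a b → P κ r a ≈ + 0 → P κ (- r) b ≈ + 0 → ¬ (a ≈ b)
  cross-distinct {r} √5r a b P₊a≈0 P₋b≈0 a≈b = P₊≈0⇒P₋≉0 a √5r P₊a≈0 (≈-trans (P-≈ (- r) a≈b) P₋b≈0)

  four-roots : ∀ {r} → √5 r → ∀ t t′ → t * t ≈ E κ r → t′ * t′ ≈ E κ (- r) → RootCountIs p (B₂ κ) 4
  four-roots {r} √5r t t′ t²≈E₊ t′²≈E₋ =
    simple-roots⇒RootCountIs (B₂ κ) (+.y₊ ∷ +.y₋ ∷ -.y₊ ∷ -.y₋ ∷ [])
      (P≈0⇒root +.y₊ √5r +.P-y₊ ∷ P≈0⇒root +.y₋ √5r +.P-y₋ ∷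
       P≈0⇒root -.y₊ √5-r -.P-y₊ ∷ P≈0⇒root -.y₋ √5-r -.P-y₋ ∷ [])
      ((+.y₊≉y₋ ∷ cross +.y₊ -.y₊ +.P-y₊ -.P-y₊ ∷ cross +.y₊ -.y₋ +.P-y₊ -.P-y₋ ∷ []) ∷
       (cross +.y₋ -.y₊ +.P-y₋ -.P-y₊ ∷ cross +.y₋ -.y₋ +.P-y₋ -.P-y₋ ∷ []) ∷
       (-.y₊≉y₋ ∷ []) ∷ [] ∷ [])
      (λ {y} root → complete y root) (λ {y} → roots-simple y)
    where
    √5-r = √5-neg √5r
    module + = RootsOfP √5r t t²≈E₊
    module - = RootsOfP √5-r t′ t′²≈E₋
    cross = cross-distinct √5r
    complete : ∀ y → Root y → Any (y ≈_) (+.y₊ ∷ +.y₋ ∷ -.y₊ ∷ -.y₋ ∷ [])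
    complete y root = [ (λ P₊≈0 → [ here , there ∘ here ]′ (+.P≈0⇒y₊⊎y₋ y P₊≈0)) ,
                        (λ P₋≈0 → [ there ∘ there ∘ here , there ∘ there ∘ there ∘ here ]′ (-.P≈0⇒y₊⊎y₋ y P₋≈0)) ]′
                      (root⇒P₊⊎P₋ y √5r root)

  two-roots : ∀ {r} → √5 r → ∀ t → t * t ≈ E κ r → ¬ Square (E κ (- r)) → RootCountIs p (B₂ κ) 2
  two-roots {r} √5r t t²≈E₊ ¬□E₋ =
    simple-roots⇒RootCountIs (B₂ κ) (+.y₊ ∷ +.y₋ ∷ [])
      (P≈0⇒root +.y₊ √5r +.P-y₊ ∷ P≈0⇒root +.y₋ √5r +.P-y₋ ∷ [])
      ((+.y₊≉y₋ ∷ []) ∷ [] ∷ [])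
      (λ {y} root → complete y root) (λ {y} → roots-simple y)
    where
    module + = RootsOfP √5r t t²≈E₊
    complete : ∀ y → Root y → Any (y ≈_) (+.y₊ ∷ +.y₋ ∷ [])
    complete y root = [ (λ P₊≈0 → [ here , there ∘ here ]′ (+.P≈0⇒y₊⊎y₋ y P₊≈0)) ,
                        (λ P₋≈0 → ⊥-elim (¬□E₋ (T (- r) y , P≈0⇒T²≈E y (√5-neg √5r) P₋≈0))) ]′
                      (root⇒P₊⊎P₋ y √5r root)

  E₊≉E₋ : ∀ {r} → √5 r → ¬ (E κ r ≈ E κ (- r))
  E₊≉E₋ {r} √5r E₊≈E₋ = √5≉0 √5r (x*y≈0⇒y≈0 (*-≉0 4≉0 5≉0)
                          (≈-trans (≈-reflexive (sym (E₊-E₋≡20r κ r))) (a≈b⇒a-b≈0 E₊≈E₋)))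

  E-squares⇒η-square : ∀ {r} → √5 r → ∀ t t′ → t * t ≈ E κ r → t′ * t′ ≈ E κ (- r) → Square (η κ)
  E-squares⇒η-square {r} √5r t t′ t²≈E₊ t′²≈E₋ = q * (t * t′) , (begin
    (q * (t * t′)) * (q * (t * t′))    ≡⟨ regroup q t t′ ⟩
    (q * q) * ((t * t) * (t′ * t′))    ≈⟨ *-congˡ (q * q) (≈-trans (*-cong t²≈E₊ t′²≈E₋) (E₊E₋≈16η √5r)) ⟩
    (q * q) * (+ 16 * η κ)             ≡⟨ regroup′ q (η κ) ⟩
    (+ 4 * q) * (+ 4 * q) * η κ        ≈⟨ *-congʳ (η κ) (*-cong 4q≈1 4q≈1) ⟩
    + 1 * + 1 * η κ                    ≡⟨ ℤₚ.*-identityˡ (η κ) ⟩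
    η κ                                ∎)
    where
    open ≈-Reasoning
    regroup : ∀ q t t′ → (q * (t * t′)) * (q * (t * t′)) ≡ (q * q) * ((t * t) * (t′ * t′))
    regroup = solve-∀
    regroup′ : ∀ q e → (q * q) * (+ 16 * e) ≡ (+ 4 * q) * (+ 4 * q) * e
    regroup′ = solve-∀

  η-square⇒E₋-square : ∀ {r} → √5 r → ∀ t → t * t ≈ E κ r → Square (η κ) → Square (E κ (- r))
  η-square⇒E₋-square {r} √5r t t²≈E₊ (s , s²≈η) = Square-of-ratio {x = + 4 * s} t≉0 (begin
    (+ 4 * s) * (+ 4 * s)         ≡⟨ regroup s ⟩
    + 16 * (s * s)                ≈⟨ *-congˡ (+ 16) s²≈η ⟩
    + 16 * η κ                    ≈⟨ E₊E₋≈16η √5r ⟨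
    E κ r * E κ (- r)             ≈⟨ *-congʳ (E κ (- r)) t²≈E₊ ⟨
    (t * t) * E κ (- r)           ≡⟨ ℤₚ.*-comm (t * t) (E κ (- r)) ⟩
    E κ (- r) * (t * t)           ∎)
    where
    open ≈-Reasoning
    t≉0 = RootsOfP.t≉0 √5r t t²≈E₊
    regroup : ∀ s → (+ 4 * s) * (+ 4 * s) ≡ + 16 * (s * s)
    regroup = solve-∀

  2q≉0 : ¬ (+ 2 * q ≈ + 0)
  2q≉0 2q≈0 = +n≉0 (s≤s z≤n) (ℕₚ.<-trans (s≤s (s≤s z≤n)) 3<p)
                (≈-trans (≈-sym 4q≈1) (≈-trans (≈-reflexive (regroup q)) (*-≈0ʳ (+ 2) 2q≈0)))
    where
    regroup : ∀ q → + 4 * q ≡ + 2 * (+ 2 * q)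
    regroup = solve-∀

  t+t′≉0 : ∀ {r} → √5 r → ∀ t t′ → t * t ≈ E κ r → t′ * t′ ≈ E κ (- r) → ¬ (t + t′ ≈ + 0)
  t+t′≉0 {r} √5r t t′ t²≈E₊ t′²≈E₋ t+t′≈0 = E₊≉E₋ √5r (begin
    E κ r          ≈⟨ t²≈E₊ ⟨
    t * t          ≈⟨ *-cong t≈-t′ t≈-t′ ⟩
    - t′ * - t′    ≡⟨ neg-square t′ ⟩
    t′ * t′        ≈⟨ t′²≈E₋ ⟩
    E κ (- r)      ∎)
    where
    open ≈-Reasoning
    minus-neg : ∀ t t′ → t - - t′ ≡ t + t′
    minus-neg = solve-∀
    neg-square : ∀ t → - t * - t ≡ t * t
    neg-square = solve-∀
    t≈-t′ : t ≈ - t′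
    t≈-t′ = a-b≈0⇒a≈b (≈-trans (≈-reflexive (minus-neg t t′)) t+t′≈0)

  [2q[t+t′]]²≈A+2qtt′ : ∀ {r} → √5 r → ∀ t t′ → t * t ≈ E κ r → t′ * t′ ≈ E κ (- r) →
                         (+ 2 * q * (t + t′)) * (+ 2 * q * (t + t′)) ≈ A κ + + 2 * (q * (t * t′))
  [2q[t+t′]]²≈A+2qtt′ {r} √5r t t′ t²≈E₊ t′²≈E₋ = begin
    (+ 2 * q * (t + t′)) * (+ 2 * q * (t + t′))                 ≡⟨ expand q t t′ ⟩
    (+ 4 * q) * (q * (t * t + t′ * t′) + + 2 * (q * (t * t′)))
      ≈⟨ *-cong 4q≈1 (+-congʳ (+ 2 * (q * (t * t′))) q[t²+t′²]≈A) ⟩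
    + 1 * (A κ + + 2 * (q * (t * t′)))                          ≡⟨ ℤₚ.*-identityˡ (A κ + + 2 * (q * (t * t′))) ⟩
    A κ + + 2 * (q * (t * t′))                                  ∎
    where
    open ≈-Reasoning
    expand : ∀ q t t′ → (+ 2 * q * (t + t′)) * (+ 2 * q * (t + t′))
                        ≡ (+ 4 * q) * (q * (t * t + t′ * t′) + + 2 * (q * (t * t′)))
    expand = solve-∀
    regroup : ∀ q a → q * (+ 4 * a) ≡ (+ 4 * q) * a
    regroup = solve-∀
    q[t²+t′²]≈A : q * (t * t + t′ * t′) ≈ A κ
    q[t²+t′²]≈A = begin
      q * (t * t + t′ * t′)       ≈⟨ *-congˡ q (+-cong t²≈E₊ t′²≈E₋) ⟩
      q * (E κ r + E κ (- r))     ≡⟨ cong (λ z → q * z) (E₊+E₋≡4A κ r) ⟩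
      q * (+ 4 * A κ)             ≡⟨ regroup q (A κ) ⟩
      (+ 4 * q) * A κ             ≈⟨ *-congʳ (A κ) 4q≈1 ⟩
      + 1 * A κ                   ≡⟨ ℤₚ.*-identityˡ (A κ) ⟩
      A κ                         ∎

  Case4-from-squares : ∀ {r} → √5 r → ∀ t t′ → t * t ≈ E κ r → t′ * t′ ≈ E κ (- r) → Case4 p κ
  Case4-from-squares {r} √5r t t′ t²≈E₊ t′²≈E₋ =
    LegendreIs1-intro η≉0 □η , LegendreIs1-intro 5≉0 (r , r²≈5 √5r) , s , ≈⇒≡[mod] (proj₂ □η) ,
    LegendreIs1-intro (nonzero (t+t′≉0 √5r t t′ t²≈E₊ t′²≈E₋) u²≈) (u , u²≈) ,
    LegendreIs1-intro (nonzero (t+t′≉0 √5r t (- t′) t²≈E₊ -t′²≈E₋) v²≈) (v , v²≈)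
    where
    □η = E-squares⇒η-square √5r t t′ t²≈E₊ t′²≈E₋
    s = proj₁ □η
    u = + 2 * q * (t + t′)
    v = + 2 * q * (t + - t′)

    -t′²≈E₋ : - t′ * - t′ ≈ E κ (- r)
    -t′²≈E₋ = ≈-trans (≈-reflexive (neg-square t′)) t′²≈E₋
      where
      neg-square : ∀ t → - t * - t ≡ t * t
      neg-square = solve-∀

    u²≈ : u * u ≈ A κ + + 2 * s
    u²≈ = [2q[t+t′]]²≈A+2qtt′ √5r t t′ t²≈E₊ t′²≈E₋

    v²≈ : v * v ≈ A κ - + 2 * s
    v²≈ = ≈-trans ([2q[t+t′]]²≈A+2qtt′ √5r t (- t′) t²≈E₊ -t′²≈E₋) (≈-reflexive (flip-sign (A κ) q t t′))
      where
      flip-sign : ∀ a q t t′ → a + + 2 * (q * (t * - t′)) ≡ a - + 2 * (q * (t * t′))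
      flip-sign = solve-∀

    nonzero : ∀ {w c} → ¬ (t + w ≈ + 0) → (+ 2 * q * (t + w)) * (+ 2 * q * (t + w)) ≈ c → ¬ (c ≈ + 0)
    nonzero t+w≉0 x²≈c c≈0 = t+w≉0 (x*y≈0⇒y≈0 2q≉0 (x*x≈0⇒x≈0 (≈-trans x²≈c c≈0)))

  E-square⇒two-roots : ¬ Square (η κ) → ∀ {r} → √5 r → Square (E κ r) → RootCountIs p (B₂ κ) 2
  E-square⇒two-roots ¬□η √5r (t , t²≈E₊) =
    two-roots √5r t t²≈E₊ (λ (t′ , t′²≈E₋) → ¬□η (E-squares⇒η-square √5r t t′ t²≈E₊ t′²≈E₋))

  four-roots-from-uv : ∀ {r} → √5 r → ∀ u v {s} → u * v ≈ + 5 * r →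
                       u * u ≈ A κ + + 2 * s → v * v ≈ A κ - + 2 * s → RootCountIs p (B₂ κ) 4
  four-roots-from-uv {r} √5r u v {s} uv≈5r u²≈ v²≈ = four-roots √5r (u + v) (u - v) [u+v]²≈E₊ [u-v]²≈E₋
    where
    open ≈-Reasoning
    [u+v]²≈E₊ : (u + v) * (u + v) ≈ E κ r
    [u+v]²≈E₊ = begin
      (u + v) * (u + v)                                      ≡⟨ expand u v ⟩
      u * u + v * v + + 2 * (u * v)                          ≈⟨ +-cong (+-cong u²≈ v²≈) (*-congˡ (+ 2) uv≈5r) ⟩
      (A κ + + 2 * s) + (A κ - + 2 * s) + + 2 * (+ 5 * r)    ≡⟨ collect κ s r ⟩
      E κ r                                                  ∎
      where
      expand : ∀ u v → (u + v) * (u + v) ≡ u * u + v * v + + 2 * (u * v)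
      expand = solve-∀
      collect : ∀ k s r → ((+ 8 * k - + 17) + + 2 * s) + ((+ 8 * k - + 17) - + 2 * s) + + 2 * (+ 5 * r)
                          ≡ + 16 * k - + 34 + + 10 * r
      collect = solve-∀
    [u-v]²≈E₋ : (u - v) * (u - v) ≈ E κ (- r)
    [u-v]²≈E₋ = begin
      (u - v) * (u - v)                                      ≡⟨ expand u v ⟩
      u * u + v * v - + 2 * (u * v)                          ≈⟨ sub-cong (+-cong u²≈ v²≈) (*-congˡ (+ 2) uv≈5r) ⟩
      (A κ + + 2 * s) + (A κ - + 2 * s) - + 2 * (+ 5 * r)    ≡⟨ collect κ s r ⟩
      E κ (- r)                                              ∎
      where
      expand : ∀ u v → (u - v) * (u - v) ≡ u * u + v * v - + 2 * (u * v)
      expand = solve-∀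
      collect : ∀ k s r → ((+ 8 * k - + 17) + + 2 * s) + ((+ 8 * k - + 17) - + 2 * s) - + 2 * (+ 5 * r)
                          ≡ + 16 * k - + 34 + + 10 * (- r)
      collect = solve-∀

  Case4⇒four-roots : Case4 p κ → RootCountIs p (B₂ κ) 4
  Case4⇒four-roots (_ , (_ , r , r²≡5) , s , s²≡η , (_ , u , u²≡) , (_ , v , v²≡)) =
    [ (λ uv≈5r → four-roots-from-uv √5r u v uv≈5r u²≈ v²≈) ,
      (λ uv≈-5r → four-roots-from-uv (√5-neg √5r) u v (≈-trans uv≈-5r (≈-reflexive (neg-distrib r)))
                                     u²≈ v²≈) ]′
    (x²≈y²⇒x≈±y [uv]²≈[5r]²)
    where
    open ≈-Reasoning
    √5r = √5-intro (≡[mod]⇒≈ r²≡5)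
    u²≈ = ≡[mod]⇒≈ u²≡
    v²≈ = ≡[mod]⇒≈ v²≡
    [uv]²≈[5r]² : (u * v) * (u * v) ≈ (+ 5 * r) * (+ 5 * r)
    [uv]²≈[5r]² = begin
      (u * v) * (u * v)                        ≡⟨ interchange u v ⟩
      (u * u) * (v * v)                        ≈⟨ *-cong u²≈ v²≈ ⟩
      (A κ + + 2 * s) * (A κ - + 2 * s)        ≡⟨ difference-of-squares (A κ) s ⟩
      A κ * A κ - + 4 * (s * s)                ≈⟨ sub-cong (≈-refl {A κ * A κ}) (*-congˡ (+ 4) (≡[mod]⇒≈ s²≡η)) ⟩
      A κ * A κ - + 4 * η κ                    ≡⟨ A²-4η≡125 κ ⟩
      + 25 * + 5                               ≈⟨ *-congˡ (+ 25) (r²≈5 √5r) ⟨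
      + 25 * (r * r)                           ≡⟨ interchange′ r ⟩
      (+ 5 * r) * (+ 5 * r)                    ∎
      where
      interchange : ∀ u v → (u * v) * (u * v) ≡ (u * u) * (v * v)
      interchange = solve-∀
      difference-of-squares : ∀ a s → (a + + 2 * s) * (a - + 2 * s) ≡ a * a - + 4 * (s * s)
      difference-of-squares = solve-∀
      interchange′ : ∀ r → + 25 * (r * r) ≡ (+ 5 * r) * (+ 5 * r)
      interchange′ = solve-∀
    neg-distrib : ∀ r → - (+ 5 * r) ≡ + 5 * - r
    neg-distrib = solve-∀

  Case2⇒two-roots : Case2 p κ → RootCountIs p (B₂ κ) 2
  -- Which of E κ r and E κ (- r) is a square is only known up to double negation,
  -- which suffices because the root count is a natural number.
  Case2⇒two-roots ((_ , ¬□η) , (_ , r , r²≡5)) mult is-mult =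
    decidable-stable (sum (map mult (upTo p)) ℕ.≟ 2) λ count≢2 →
      nonsquare*nonsquare 2<p
        (λ □E₊ → count≢2 (E-square⇒two-roots ¬□η′ √5r □E₊ mult is-mult))
        (λ □E₋ → count≢2 (E-square⇒two-roots ¬□η′ (√5-neg √5r) □E₋ mult is-mult))
        (λ (x , x²≈E₊E₋) → ¬□η′ (Square-of-ratio {x = x} 4≉0 (begin
          x * x                   ≈⟨ x²≈E₊E₋ ⟩
          E κ r * E κ (- r)       ≈⟨ E₊E₋≈16η √5r ⟩
          + 16 * η κ              ≡⟨ ℤₚ.*-comm (+ 16) (η κ) ⟩
          η κ * (+ 4 * + 4)       ∎)))
    where
    open ≈-Reasoning
    2<p = ℕₚ.<-trans (ℕₚ.n<1+n 2) 3<p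
    ¬□η′ = ¬□η ∘ Square⇒IsSquareMod
    √5r = √5-intro (≡[mod]⇒≈ r²≡5)

  root⇒E-square : ∀ y → Root y → ∃ λ r → √5 r × Square (E κ r)
  root⇒E-square y root = for-√5 (root⇒√5 y root)
    where
    for-√5 : ∃ √5 → ∃ λ r → √5 r × Square (E κ r)
    for-√5 (r , √5r) =
      [ (λ P₊≈0 → r , √5r , T r y , P≈0⇒T²≈E y √5r P₊≈0) ,
        (λ P₋≈0 → - r , √5-neg √5r , T (- r) y , P≈0⇒T²≈E y (√5-neg √5r) P₋≈0) ]′
      (root⇒P₊⊎P₋ y √5r root)

  ¬Case4∧¬Case2⇒no-root : ¬ Case4 p κ → ¬ Case2 p κ → ∀ y → ¬ Root y
  ¬Case4∧¬Case2⇒no-root ¬C4 ¬C2 y root = with-E-square (root⇒E-square y root)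
    where
    with-E-square : (∃ λ r → √5 r × Square (E κ r)) → ⊥
    with-E-square (r , √5r , t , t²≈E₊) = ¬¬□η □η⇒⊥
      where
      ¬¬□η : ¬ ¬ Square (η κ)
      ¬¬□η ¬□η = ¬C2 ((η≉0 ∘ ≡[mod]⇒≈ , ¬□η ∘ IsSquareMod⇒Square) ,
                      LegendreIs1-intro 5≉0 (r , r²≈5 √5r))
      □E₋⇒⊥ : ¬ Square (E κ (- r))
      □E₋⇒⊥ (t′ , t′²≈E₋) = ¬C4 (Case4-from-squares √5r t t′ t²≈E₊ t′²≈E₋)
      □η⇒⊥ : ¬ Square (η κ)
      □η⇒⊥ = □E₋⇒⊥ ∘ η-square⇒E₋-square √5r t t²≈E₊

  ¬Case4∧¬Case2⇒zero-roots : ¬ Case4 p κ → ¬ Case2 p κ → RootCountIs p (B₂ κ) 0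
  ¬Case4∧¬Case2⇒zero-roots ¬C4 ¬C2 =
    simple-roots⇒RootCountIs (B₂ κ) [] [] [] (λ {y} root → ⊥-elim (¬Case4∧¬Case2⇒no-root ¬C4 ¬C2 y root))
                                               (λ {y} → roots-simple y)

proposition4p3 : (p : ℕ) → Prime p → 3 < p → (κ : ℤ) →
    ¬ (κ ≡ + 4 [mod p ]) →
    ¬ ((κ * κ - + 13 * κ + + 11) * η κ ≡ + 0 [mod p ]) →
    ¬ (+ 5 * (κ * κ - + 73 * κ + + 61) ≡ + 0 [mod p ]) →
    (Case4 p κ → RootCountIs p (B₂ κ) 4) ×
    (Case2 p κ → RootCountIs p (B₂ κ) 2) ×
    (¬ Case4 p κ → ¬ Case2 p κ → RootCountIs p (B₂ κ) 0)
proposition4p3 p p-prime 3<p κ κ≢4 [κ²-13κ+11]η≢0 5[κ²-73κ+61]≢0 =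
  Case4⇒four-roots , Case2⇒two-roots , ¬Case4∧¬Case2⇒zero-roots
  where
  open Congruence p
  η≉0 : ¬ (η κ ≈ + 0)
  η≉0 η≈0 = [κ²-13κ+11]η≢0 (≈⇒≡[mod] (*-≈0ʳ (κ * κ - + 13 * κ + + 11) η≈0))
  5≉0 : ¬ (+ 5 ≈ + 0)
  5≉0 5≈0 = 5[κ²-73κ+61]≢0 (≈⇒≡[mod] (*-≈0ˡ (κ * κ - + 73 * κ + + 61) 5≈0))
  open B₂Roots p p-prime 3<p κ (κ≢4 ∘ ≈⇒≡[mod]) η≉0 5≉0
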